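{- Let $s,n\ge1$. The proportion of ordered pairs $(\alpha,\beta)\in\mathcal C(s,n)\times\mathcal C(s,n)$ such that $\mathrm{EMC}(\alpha,\beta)=|\mathcal D(\alpha,\beta)|$ equals $$\frac{2(s+n)}{n(s+1)}-\frac{(n-1)!}{(s+1)(s+2)\cdots(s+n-1)}.$$
   Context: $\mathcal C(s,n)$ is the set of $n$-tuples $(a_0,\ldots,a_{n-1})$ of nonnegative integers with sum $s$. Earth mover's coefficient: for $\alpha=(a_0,\ldots,a_{n-1}),\beta=(b_0,\ldots,b_{n-1})\in\mathcal C(s,n)$, $\mathrm{EMC}(\alpha,\beta)$ is the minimum of $\sum_{i,j=0}^{n-1}|i-j|\,J(i,j)$ over all $n\times n$ matrices $J$ of nonnegative integers with $\sum_j J(i,j)=a_i$ and $\sum_i J(i,j)=b_j$. Weighted total and weighted difference: $\mathcal T(\alpha)=\sum_{i=0}^{n-1} i\,a_i$ and $\mathcal D(\alpha,\beta)=\mathcal T(\alpha)-\mathcal T(\beta)$. -}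

module Defs where

open import Data.Nat as ℕ using (ℕ; zero; suc; _+_; _*_; ∣_-_∣; NonZero; _!)
open import Data.Nat.Properties using (m*n≢0)
open import Data.Integer as ℤ using (ℤ; +_)
open import Data.Rational using (ℚ; _/_; _-_)
open import Data.Fin using (Fin; toℕ)
open import Data.Vec using (Vec; sum; map; lookup; tabulate; transpose)
open import Data.Product using (Σ; _×_; _,_)
open import Relation.Binary.PropositionalEquality using (_≡_)

InC : (s n : ℕ) → Vec ℕ n → Set
InC s n α = sum α ≡ s

Σ[<_] : (n : ℕ) → (Fin n → ℕ) → ℕ
Σ[< n ] f = sum (tabulate f)

entry : {n : ℕ} → Vec (Vec ℕ n) n → Fin n → Fin n → ℕ
entry J i j = lookup (lookup J i) j

IsPlan : {n : ℕ} → Vec ℕ n → Vec ℕ n → Vec (Vec ℕ n) n → Set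
IsPlan α β J = (map sum J ≡ α) × (map sum (transpose J) ≡ β)

cost : {n : ℕ} → Vec (Vec ℕ n) n → ℕ
cost {n} J = Σ[< n ] (λ i → Σ[< n ] (λ j → ∣ toℕ i - toℕ j ∣ * entry J i j))

IsEMC : {n : ℕ} → Vec ℕ n → Vec ℕ n → ℕ → Set
IsEMC {n} α β m =
  (Σ (Vec (Vec ℕ n) n) λ J → IsPlan α β J × (cost J ≡ m)) ×
  ((J : Vec (Vec ℕ n) n) → IsPlan α β J → m ℕ.≤ cost J)

𝒯 : {n : ℕ} → Vec ℕ n → ℕ
𝒯 {n} α = Σ[< n ] (λ i → toℕ i * lookup α i)

𝒟 : {n : ℕ} → Vec ℕ n → Vec ℕ n → ℤ
𝒟 α β = + 𝒯 α ℤ.- + 𝒯 β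

rising : ℕ → ℕ → ℕ
rising s zero = 1
rising s (suc k) = rising s k * (s + suc k)

rising-nonZero : ∀ s k → NonZero (rising s k)
rising-nonZero s zero = _
rising-nonZero s (suc k) =
  m*n≢0 (rising s k) (s + suc k) {{rising-nonZero s k}} {{nz s k}}
  where
  nz : ∀ s k → NonZero (s + suc k)
  nz zero k = _
  nz (suc s) k = _

formula : (s n : ℕ) → .{{NonZero n}} → ℚ
formula s (suc m) =
  (+ (2 * (s + suc m)) / (suc m * suc s))
  - (+ (m !) / rising s m) {{rising-nonZero s m}}

{-# OPTIONS --safe #-}

-- A coupling f of α and β moves a mass R to the right and L to the left. Comparing first moments
-- gives 𝒯 α + R = 𝒯 β + L, while the cost of f is R + L; so every cost is at least |𝒟 α β|, with
-- equality exactly when f moves mass in one direction only. A coupling that only moves mass to the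
-- right exists iff every suffix of α carries at most the mass of the same suffix of β (α ≼ β):
-- necessity by summing f against suffix indicators, sufficiency by greedily pairing leftmost units.
-- Hence the good pairs are the ≼-comparable ones, and their number is twice the number D of pairs
-- with α ≼ β minus the number of compositions on the diagonal. Building dominated pairs by
-- prepending heads, D = C(s+m,m)² - C(s+m,m+1) C(s+m,m-1) for n = m + 1, and the absorption
-- identities turn this into the stated proportion.
module Submission where

open import Defs
open import Data.Vec as Vec using (Vec; []; _∷_)
open import Data.List as List using (List; length)
open import Data.List.Membership.Propositional using (_∈_)
open import Data.List.Relation.Unary.Unique.Propositional using (Unique)
open import Data.Product using (Σ; _×_; _,_; proj₁; proj₂; swap)
open import Data.Sum using (_⊎_; inj₁; inj₂)
open import Data.Empty using (⊥-elim)
open import Function using (_∘_; flip)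
open import Function.Bundles using (_⇔_; mk⇔; Equivalence)
open import Relation.Binary.PropositionalEquality hiding ([_])
import Data.Integer as ℤ
open Equivalence using (to; from)

module Transport where

  open import Data.Nat using (ℕ; zero; suc; _+_; _*_; _∸_; _⊓_; _≤_; _<_; z≤n; s≤s; ∣_-_∣)
  open import Data.Nat.Properties
  open import Data.Nat.Tactic.RingSolver using (solve-∀)
  open import Data.Fin as Fin using (Fin; toℕ)
  open import Data.Vec using (lookup; tabulate; transpose; replicate; _⊛_)
  open import Data.Vec.Properties
    using (tabulate∘lookup; lookup∘tabulate; lookup-map; lookup-⊛; lookup-replicate)
  open import Data.Vec.Relation.Binary.Pointwise.Extensional using (ext; Pointwise-≡⇒≡)
  open import Algebra.Properties.Semiring.Sum +-*-semiring
    using (sum-syntax; sum-cong-≗; ∑-distrib-+; ∑-comm; *-distribˡ-sum; *-distribʳ-sum)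
  open import Data.Unit using (⊤; tt)
  import Data.Integer.Properties as ℤ
  open import Function.Construct.Composition using (_⇔-∘_)

  Σ[<]≡∑ : ∀ n (f : Fin n → ℕ) → Σ[< n ] f ≡ ∑[ i < n ] f i
  Σ[<]≡∑ zero    f = refl
  Σ[<]≡∑ (suc n) f = cong (f Fin.zero +_) (Σ[<]≡∑ n (f ∘ Fin.suc))

  sum≡∑-lookup : ∀ {n} (v : Vec ℕ n) → Vec.sum v ≡ ∑[ i < n ] lookup v i
  sum≡∑-lookup v = trans (cong Vec.sum (sym (tabulate∘lookup v))) (Σ[<]≡∑ _ (lookup v))

  ∑-mono-≤ : ∀ {n} {f g : Fin n → ℕ} → (∀ i → f i ≤ g i) → ∑[ i < n ] f i ≤ ∑[ i < n ] g i
  ∑-mono-≤ {zero}  f≤g = z≤n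
  ∑-mono-≤ {suc n} f≤g = +-mono-≤ (f≤g Fin.zero) (∑-mono-≤ (f≤g ∘ Fin.suc))

  ∑≡0⇒≡0 : ∀ {n} (f : Fin n → ℕ) → ∑[ i < n ] f i ≡ 0 → ∀ i → f i ≡ 0
  ∑≡0⇒≡0 f eq Fin.zero    = m+n≡0⇒m≡0 (f Fin.zero) eq
  ∑≡0⇒≡0 f eq (Fin.suc i) = ∑≡0⇒≡0 (f ∘ Fin.suc) (m+n≡0⇒n≡0 (f Fin.zero) eq) i

  ≡0⇒∑≡0 : ∀ {n} {f : Fin n → ℕ} → (∀ i → f i ≡ 0) → ∑[ i < n ] f i ≡ 0
  ≡0⇒∑≡0 {zero}  f≡0 = refl
  ≡0⇒∑≡0 {suc n} f≡0 = cong₂ _+_ (f≡0 Fin.zero) (≡0⇒∑≡0 (f≡0 ∘ Fin.suc))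

  lookup-transpose : ∀ {m n} {A : Set} (J : Vec (Vec A n) m) i j →
    lookup (lookup (transpose J) j) i ≡ lookup (lookup J i) j
  lookup-transpose (as ∷ ass) i j = trans (cong (λ v → lookup v i) column-∷) (go i)
    where
    column-∷ : lookup (transpose (as ∷ ass)) j ≡ lookup as j ∷ lookup (transpose ass) j
    column-∷ = begin
      lookup (replicate _ _∷_ ⊛ as ⊛ transpose ass) j
        ≡⟨ lookup-⊛ j (replicate _ _∷_ ⊛ as) (transpose ass) ⟩
      lookup (replicate _ _∷_ ⊛ as) j (lookup (transpose ass) j)
        ≡⟨ cong (λ g → g (lookup (transpose ass) j)) (lookup-⊛ j (replicate _ _∷_) as) ⟩
      lookup (replicate _ _∷_) j (lookup as j) (lookup (transpose ass) j)
        ≡⟨ cong (λ g → g (lookup as j) (lookup (transpose ass) j)) (lookup-replicate j _∷_) ⟩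
      lookup as j ∷ lookup (transpose ass) j ∎
      where open ≡-Reasoning
    go : ∀ i → lookup (lookup as j ∷ lookup (transpose ass) j) i ≡ lookup (lookup (as ∷ ass) i) j
    go Fin.zero    = refl
    go (Fin.suc i) = lookup-transpose ass i j

  Coupling : ℕ → Set
  Coupling n = Fin n → Fin n → ℕ

  record IsCoupling {n} (α β : Vec ℕ n) (f : Coupling n) : Set where
    constructor isCoupling
    field
      rowSums : ∀ i → lookup α i ≡ ∑[ j < n ] f i j
      colSums : ∀ j → lookup β j ≡ ∑[ i < n ] f i j

  transpose-isCoupling : ∀ {n} {α β : Vec ℕ n} {f : Coupling n} → IsCoupling α β f → IsCoupling β α (flip f)
  transpose-isCoupling (isCoupling rowSums colSums) = isCoupling colSums rowSums

  matrix : ∀ {n} → Coupling n → Vec (Vec ℕ n) n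
  matrix f = tabulate (λ i → tabulate (f i))

  entry-matrix : ∀ {n} (f : Coupling n) i j → entry (matrix f) i j ≡ f i j
  entry-matrix f i j = trans (cong (λ v → lookup v j) (lookup∘tabulate _ i)) (lookup∘tabulate (f i) j)

  isPlan⇒isCoupling : ∀ {n} {α β : Vec ℕ n} (J : Vec (Vec ℕ n) n) → IsPlan α β J → IsCoupling α β (entry J)
  isPlan⇒isCoupling {n} {α} {β} J (rows , cols) = isCoupling rowSums colSums
    where
    rowSums : ∀ i → lookup α i ≡ ∑[ j < n ] entry J i j
    rowSums i = begin
      lookup α i                  ≡⟨ cong (λ v → lookup v i) rows ⟨
      lookup (Vec.map Vec.sum J) i ≡⟨ lookup-map i Vec.sum J ⟩
      Vec.sum (lookup J i)        ≡⟨ sum≡∑-lookup (lookup J i) ⟩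
      ∑[ j < n ] entry J i j      ∎
      where open ≡-Reasoning
    colSums : ∀ j → lookup β j ≡ ∑[ i < n ] entry J i j
    colSums j = begin
      lookup β j                                   ≡⟨ cong (λ v → lookup v j) cols ⟨
      lookup (Vec.map Vec.sum (transpose J)) j     ≡⟨ lookup-map j Vec.sum (transpose J) ⟩
      Vec.sum (lookup (transpose J) j)             ≡⟨ sum≡∑-lookup (lookup (transpose J) j) ⟩
      ∑[ i < n ] lookup (lookup (transpose J) j) i ≡⟨ sum-cong-≗ (λ i → lookup-transpose J i j) ⟩
      ∑[ i < n ] entry J i j                       ∎
      where open ≡-Reasoning

  isCoupling⇒isPlan : ∀ {n} {α β : Vec ℕ n} (f : Coupling n) → IsCoupling α β f → IsPlan α β (matrix f)
  isCoupling⇒isPlan {n} {α} {β} f (isCoupling rowSums colSums) = Pointwise-≡⇒≡ (ext rows) , Pointwise-≡⇒≡ (ext cols)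
    where
    rows : ∀ i → lookup (Vec.map Vec.sum (matrix f)) i ≡ lookup α i
    rows i = begin
      lookup (Vec.map Vec.sum (matrix f)) i ≡⟨ lookup-map i Vec.sum (matrix f) ⟩
      Vec.sum (lookup (matrix f) i)         ≡⟨ cong Vec.sum (lookup∘tabulate _ i) ⟩
      Σ[< n ] (f i)                         ≡⟨ Σ[<]≡∑ n (f i) ⟩
      ∑[ j < n ] f i j                      ≡⟨ rowSums i ⟨
      lookup α i                            ∎
      where open ≡-Reasoning
    cols : ∀ j → lookup (Vec.map Vec.sum (transpose (matrix f))) j ≡ lookup β j
    cols j = begin
      lookup (Vec.map Vec.sum (transpose (matrix f))) j ≡⟨ lookup-map j Vec.sum (transpose (matrix f)) ⟩
      Vec.sum (lookup (transpose (matrix f)) j)         ≡⟨ sum≡∑-lookup (lookup (transpose (matrix f)) j) ⟩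
      ∑[ i < n ] lookup (lookup (transpose (matrix f)) j) i
        ≡⟨ sum-cong-≗ (λ i → trans (lookup-transpose (matrix f) i j) (entry-matrix f i j)) ⟩
      ∑[ i < n ] f i j                                  ≡⟨ colSums j ⟨
      lookup β j                                        ∎
      where open ≡-Reasoning

  transportCost : ∀ {n} → (Fin n → Fin n → ℕ) → Coupling n → ℕ
  transportCost {n} c f = ∑[ i < n ] ∑[ j < n ] (c i j * f i j)

  transportCost-congʳ : ∀ {n} (c : Fin n → Fin n → ℕ) {f g : Coupling n} →
    (∀ i j → f i j ≡ g i j) → transportCost c f ≡ transportCost c g
  transportCost-congʳ c f≗g = sum-cong-≗ (λ i → sum-cong-≗ (λ j → cong (c i j *_) (f≗g i j)))

  transportCost-+ : ∀ {n} (c d : Fin n → Fin n → ℕ) (f : Coupling n) →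
    transportCost (λ i j → c i j + d i j) f ≡ transportCost c f + transportCost d f
  transportCost-+ {n} c d f =
    trans (sum-cong-≗ row) (∑-distrib-+ (λ i → ∑[ j < n ] (c i j * f i j)) (λ i → ∑[ j < n ] (d i j * f i j)))
    where
    row : ∀ i → ∑[ j < n ] ((c i j + d i j) * f i j) ≡ ∑[ j < n ] (c i j * f i j) + ∑[ j < n ] (d i j * f i j)
    row i = trans (sum-cong-≗ λ j → *-distribʳ-+ (f i j) (c i j) (d i j))
                  (∑-distrib-+ (λ j → c i j * f i j) (λ j → d i j * f i j))

  transportCost-flip : ∀ {n} (c : Fin n → Fin n → ℕ) (f : Coupling n) →
    transportCost c (flip f) ≡ transportCost (flip c) f
  transportCost-flip c f = ∑-comm (λ i j → c i j * f j i)

  transportCost-mono-≤ : ∀ {n} {c d : Fin n → Fin n → ℕ} (f : Coupling n) →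
    (∀ i j → c i j * f i j ≤ d i j * f i j) → transportCost c f ≤ transportCost d f
  transportCost-mono-≤ f le = ∑-mono-≤ (λ i → ∑-mono-≤ (le i))

  transportCost≡0⇔ : ∀ {n} (c : Fin n → Fin n → ℕ) (f : Coupling n) →
    transportCost c f ≡ 0 ⇔ (∀ i j → c i j * f i j ≡ 0)
  transportCost≡0⇔ c f = mk⇔
    (λ eq i → ∑≡0⇒≡0 _ (∑≡0⇒≡0 _ eq i))
    (λ terms≡0 → ≡0⇒∑≡0 (λ i → ≡0⇒∑≡0 (terms≡0 i)))

  transportCost-rows : ∀ {n} {α β : Vec ℕ n} {f : Coupling n} (w : Fin n → ℕ) → IsCoupling α β f →
    transportCost (λ i _ → w i) f ≡ ∑[ i < n ] (w i * lookup α i)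
  transportCost-rows {f = f} w (isCoupling rowSums _) =
    sum-cong-≗ λ i → trans (sym (*-distribˡ-sum (w i) (f i))) (cong (w i *_) (sym (rowSums i)))

  transportCost-cols : ∀ {n} {α β : Vec ℕ n} {f : Coupling n} (w : Fin n → ℕ) → IsCoupling α β f →
    transportCost (λ _ j → w j) f ≡ ∑[ j < n ] (w j * lookup β j)
  transportCost-cols {f = f} w coupling =
    trans (sym (transportCost-flip (λ i _ → w i) f)) (transportCost-rows w (transpose-isCoupling coupling))

  𝒯≡∑ : ∀ {n} (α : Vec ℕ n) → 𝒯 α ≡ ∑[ i < n ] (toℕ i * lookup α i)
  𝒯≡∑ {n} α = Σ[<]≡∑ n _

  rightward leftward distance : ∀ {n} → Fin n → Fin n → ℕ
  rightward i j = toℕ j ∸ toℕ i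
  leftward  i j = toℕ i ∸ toℕ j
  distance  i j = ∣ toℕ i - toℕ j ∣

  distance≡rightward+leftward : ∀ {n} (i j : Fin n) → distance i j ≡ rightward i j + leftward i j
  distance≡rightward+leftward i j with ≤-total (toℕ i) (toℕ j)
  ... | inj₁ i≤j =
    trans (m≤n⇒∣m-n∣≡n∸m i≤j) (sym (trans (cong (rightward i j +_) (m≤n⇒m∸n≡0 i≤j)) (+-identityʳ _)))
  ... | inj₂ j≤i = trans (m≤n⇒∣n-m∣≡n∸m j≤i) (cong (_+ leftward i j) (sym (m≤n⇒m∸n≡0 j≤i)))

  +rightward≡+leftward : ∀ {n} (i j : Fin n) → toℕ i + rightward i j ≡ toℕ j + leftward i j
  +rightward≡+leftward i j with ≤-total (toℕ i) (toℕ j)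
  ... | inj₁ i≤j = trans (m+[n∸m]≡n i≤j) (sym (trans (cong (toℕ j +_) (m≤n⇒m∸n≡0 i≤j)) (+-identityʳ _)))
  ... | inj₂ j≤i = trans (trans (cong (toℕ i +_) (m≤n⇒m∸n≡0 j≤i)) (+-identityʳ _)) (sym (m+[n∸m]≡n j≤i))

  transportCost-congˡ : ∀ {n} {c d : Fin n → Fin n → ℕ} (f : Coupling n) →
    (∀ i j → c i j ≡ d i j) → transportCost c f ≡ transportCost d f
  transportCost-congˡ f c≗d = sum-cong-≗ (λ i → sum-cong-≗ (λ j → cong (_* f i j) (c≗d i j)))

  cost≡transportCost : ∀ {n} (J : Vec (Vec ℕ n) n) → cost J ≡ transportCost distance (entry J)
  cost≡transportCost {n} J =
    trans (Σ[<]≡∑ n _) (sum-cong-≗ λ i → Σ[<]≡∑ n (λ j → distance i j * entry J i j))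

  𝒯-balance : ∀ {n} {α β : Vec ℕ n} {f : Coupling n} → IsCoupling α β f →
    𝒯 α + transportCost rightward f ≡ 𝒯 β + transportCost leftward f
  𝒯-balance {n} {α} {β} {f} coupling = begin
    𝒯 α + transportCost rightward f
      ≡⟨ cong (_+ transportCost rightward f) (trans (𝒯≡∑ α) (sym (transportCost-rows toℕ coupling))) ⟩
    transportCost (λ i _ → toℕ i) f + transportCost rightward f
      ≡⟨ transportCost-+ (λ i _ → toℕ i) rightward f ⟨
    transportCost (λ i j → toℕ i + rightward i j) f
      ≡⟨ transportCost-congˡ f +rightward≡+leftward ⟩
    transportCost (λ i j → toℕ j + leftward i j) f
      ≡⟨ transportCost-+ (λ _ j → toℕ j) leftward f ⟩
    transportCost (λ _ j → toℕ j) f + transportCost leftward f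
      ≡⟨ cong (_+ transportCost leftward f) (trans (transportCost-cols toℕ coupling) (sym (𝒯≡∑ β))) ⟩
    𝒯 β + transportCost leftward f ∎
    where open ≡-Reasoning

  ∣-∣+2*⊓≡+ : ∀ {x y} p q → x + p ≡ y + q → ∣ x - y ∣ + 2 * (p ⊓ q) ≡ p + q
  ∣-∣+2*⊓≡+ {x} {y} zero q eq = begin
    ∣ x - y ∣ + 0      ≡⟨ +-identityʳ _ ⟩
    ∣ x - y ∣          ≡⟨ cong ∣_- y ∣ (trans (sym (+-identityʳ x)) eq) ⟩
    ∣ y + q - y ∣      ≡⟨ ∣-∣-comm (y + q) y ⟩
    ∣ y - y + q ∣      ≡⟨ m≤n⇒∣m-n∣≡n∸m (m≤m+n y q) ⟩
    y + q ∸ y          ≡⟨ m+n∸m≡n y q ⟩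
    q                  ∎
    where open ≡-Reasoning
  ∣-∣+2*⊓≡+ {x} {y} (suc p) zero eq = begin
    ∣ x - y ∣ + 0      ≡⟨ +-identityʳ _ ⟩
    ∣ x - y ∣          ≡⟨ cong ∣ x -_∣ (trans (sym (+-identityʳ y)) (sym eq)) ⟩
    ∣ x - x + suc p ∣  ≡⟨ m≤n⇒∣m-n∣≡n∸m (m≤m+n x (suc p)) ⟩
    x + suc p ∸ x      ≡⟨ m+n∸m≡n x (suc p) ⟩
    suc p              ≡⟨ +-identityʳ (suc p) ⟨
    suc p + 0          ∎
    where open ≡-Reasoning
  ∣-∣+2*⊓≡+ {x} {y} (suc p) (suc q) eq = begin
    ∣ x - y ∣ + 2 * suc (p ⊓ q)     ≡⟨ shift ∣ x - y ∣ (p ⊓ q) ⟩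
    2 + (∣ x - y ∣ + 2 * (p ⊓ q))   ≡⟨ cong (2 +_) (∣-∣+2*⊓≡+ p q eq′) ⟩
    2 + (p + q)                     ≡⟨ cong suc (+-suc p q) ⟨
    suc p + suc q                   ∎
    where
    open ≡-Reasoning
    eq′ : x + p ≡ y + q
    eq′ = suc-injective (trans (sym (+-suc x p)) (trans eq (+-suc y q)))
    shift : ∀ d m → d + 2 * suc m ≡ 2 + (d + 2 * m)
    shift = solve-∀

  ∣+m-+n∣≡n∸m : ∀ {m n} → m ≤ n → ℤ.∣ ℤ.+ m ℤ.- ℤ.+ n ∣ ≡ n ∸ m
  ∣+m-+n∣≡n∸m {m} {n} m≤n = trans (cong ℤ.∣_∣ (ℤ.[+m]-[+n]≡m⊖n m n)) (ℤ.∣⊖∣-≤ m≤n)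

  ∣+m-+n∣≡∣m-n∣ : ∀ m n → ℤ.∣ ℤ.+ m ℤ.- ℤ.+ n ∣ ≡ ∣ m - n ∣
  ∣+m-+n∣≡∣m-n∣ m n with ≤-total m n
  ... | inj₁ m≤n = trans (∣+m-+n∣≡n∸m m≤n) (sym (m≤n⇒∣m-n∣≡n∸m m≤n))
  ... | inj₂ n≤m =
    trans (ℤ.∣i-j∣≡∣j-i∣ (ℤ.+ m) (ℤ.+ n)) (trans (∣+m-+n∣≡n∸m n≤m) (sym (m≤n⇒∣n-m∣≡n∸m n≤m)))

  ∣𝒟∣≡∣𝒯-𝒯∣ : ∀ {n} (α β : Vec ℕ n) → ℤ.∣ 𝒟 α β ∣ ≡ ∣ 𝒯 α - 𝒯 β ∣
  ∣𝒟∣≡∣𝒯-𝒯∣ α β = ∣+m-+n∣≡∣m-n∣ (𝒯 α) (𝒯 β)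

  m⊓n≡0⇔ : ∀ m n → m ⊓ n ≡ 0 ⇔ (m ≡ 0 ⊎ n ≡ 0)
  m⊓n≡0⇔ zero    n       = mk⇔ (λ _ → inj₁ refl) (λ _ → refl)
  m⊓n≡0⇔ (suc m) zero    = mk⇔ (λ _ → inj₂ refl) (λ _ → refl)
  m⊓n≡0⇔ (suc m) (suc n) = mk⇔ (λ ()) (λ { (inj₁ ()) ; (inj₂ ()) })

  module _ {n} {α β : Vec ℕ n} {f : Coupling n} (coupling : IsCoupling α β f) where

    private
      R = transportCost rightward f
      L = transportCost leftward f

    ∣𝒟∣+2*⊓≡transportCost : ℤ.∣ 𝒟 α β ∣ + 2 * (R ⊓ L) ≡ transportCost distance f
    ∣𝒟∣+2*⊓≡transportCost = begin
      ℤ.∣ 𝒟 α β ∣ + 2 * (R ⊓ L)                       ≡⟨ cong (_+ 2 * (R ⊓ L)) (∣𝒟∣≡∣𝒯-𝒯∣ α β) ⟩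
      ∣ 𝒯 α - 𝒯 β ∣ + 2 * (R ⊓ L)                     ≡⟨ ∣-∣+2*⊓≡+ R L (𝒯-balance coupling) ⟩
      R + L                                            ≡⟨ transportCost-+ rightward leftward f ⟨
      transportCost (λ i j → rightward i j + leftward i j) f
        ≡⟨ transportCost-congˡ f (λ i j → sym (distance≡rightward+leftward i j)) ⟩
      transportCost distance f                         ∎
      where open ≡-Reasoning

    ∣𝒟∣≤transportCost : ℤ.∣ 𝒟 α β ∣ ≤ transportCost distance f
    ∣𝒟∣≤transportCost = subst (ℤ.∣ 𝒟 α β ∣ ≤_) ∣𝒟∣+2*⊓≡transportCost (m≤m+n _ _)

    transportCost≡∣𝒟∣⇔ : transportCost distance f ≡ ℤ.∣ 𝒟 α β ∣ ⇔ (R ≡ 0 ⊎ L ≡ 0)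
    transportCost≡∣𝒟∣⇔ = m⊓n≡0⇔ R L ⇔-∘ mk⇔ ⊓≡0 ⊓≡0⇒
      where
      ⊓≡0 : transportCost distance f ≡ ℤ.∣ 𝒟 α β ∣ → R ⊓ L ≡ 0
      ⊓≡0 eq = m+n≡0⇒m≡0 (R ⊓ L)
        (+-cancelˡ-≡ ℤ.∣ 𝒟 α β ∣ _ 0 (trans ∣𝒟∣+2*⊓≡transportCost (trans eq (sym (+-identityʳ _)))))
      ⊓≡0⇒ : R ⊓ L ≡ 0 → transportCost distance f ≡ ℤ.∣ 𝒟 α β ∣
      ⊓≡0⇒ eq =
        trans (sym ∣𝒟∣+2*⊓≡transportCost) (trans (cong (λ m → ℤ.∣ 𝒟 α β ∣ + 2 * m) eq) (+-identityʳ _))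

  Upper : ∀ {n} → Coupling n → Set
  Upper f = ∀ i j → toℕ j < toℕ i → f i j ≡ 0

  leftward≡0⇔upper : ∀ {n} (f : Coupling n) → transportCost leftward f ≡ 0 ⇔ Upper f
  leftward≡0⇔upper f =
    mk⇔ (upper ∘ to (transportCost≡0⇔ leftward f)) (from (transportCost≡0⇔ leftward f) ∘ terms≡0)
    where
    upper : (∀ i j → leftward i j * f i j ≡ 0) → Upper f
    upper terms≡0 i j j<i with m*n≡0⇒m≡0∨n≡0 (leftward i j) (terms≡0 i j)
    ... | inj₁ i∸j≡0 = ⊥-elim (<⇒≱ j<i (m∸n≡0⇒m≤n i∸j≡0))
    ... | inj₂ fij≡0 = fij≡0
    terms≡0 : Upper f → ∀ i j → leftward i j * f i j ≡ 0
    terms≡0 u i j with ≤-<-connex (toℕ i) (toℕ j)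
    ... | inj₁ i≤j = cong (_* f i j) (m≤n⇒m∸n≡0 i≤j)
    ... | inj₂ j<i = trans (cong (leftward i j *_) (u i j j<i)) (*-zeroʳ (leftward i j))

  rightward≡0⇔upper-flip : ∀ {n} (f : Coupling n) → transportCost rightward f ≡ 0 ⇔ Upper (flip f)
  rightward≡0⇔upper-flip f =
    subst (λ m → m ≡ 0 ⇔ Upper (flip f)) (transportCost-flip leftward f) (leftward≡0⇔upper (flip f))

  infix 4 _≼_
  _≼_ : ∀ {n} → Vec ℕ n → Vec ℕ n → Set
  []      ≼ []      = ⊤
  (x ∷ α) ≼ (y ∷ β) = x + Vec.sum α ≤ y + Vec.sum β × α ≼ β

  ≼-refl : ∀ {n} (α : Vec ℕ n) → α ≼ α
  ≼-refl []      = tt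
  ≼-refl (x ∷ α) = ≤-refl , ≼-refl α

  ≼⇒sum≤ : ∀ {n} (α β : Vec ℕ n) → α ≼ β → Vec.sum α ≤ Vec.sum β
  ≼⇒sum≤ []      []      _       = z≤n
  ≼⇒sum≤ (x ∷ α) (y ∷ β) (le , _) = le

  ≼-antisym : ∀ {n} (α β : Vec ℕ n) → α ≼ β → β ≼ α → α ≡ β
  ≼-antisym []      []      _          _          = refl
  ≼-antisym (x ∷ α) (y ∷ β) (le , α≼β) (ge , β≼α) =
    cong₂ _∷_ (+-cancelʳ-≡ (Vec.sum α) x y (trans (≤-antisym le ge) (cong (y +_) (sym (cong Vec.sum α≡β))))) α≡β
    where
    α≡β = ≼-antisym α β α≼β β≼α

  upper⇒∑-mono-≤ : ∀ {n} {α β : Vec ℕ n} {f : Coupling n} → IsCoupling α β f → Upper f →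
    (w : Fin n → ℕ) → (∀ {i j} → toℕ i ≤ toℕ j → w i ≤ w j) →
    ∑[ i < n ] (w i * lookup α i) ≤ ∑[ i < n ] (w i * lookup β i)
  upper⇒∑-mono-≤ {f = f} coupling upper w mono =
    subst₂ _≤_ (transportCost-rows w coupling) (transportCost-cols w coupling)
      (transportCost-mono-≤ {c = λ i _ → w i} {d = λ _ j → w j} f termwise)
    where
    termwise : ∀ i j → w i * f i j ≤ w j * f i j
    termwise i j with ≤-<-connex (toℕ i) (toℕ j)
    ... | inj₁ i≤j = *-monoˡ-≤ (f i j) (mono i≤j)
    ... | inj₂ j<i rewrite upper i j j<i = ≤-reflexive (trans (*-zeroʳ (w i)) (sym (*-zeroʳ (w j))))

  atLeast : ℕ → ℕ → ℕ
  atLeast zero    _       = 1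
  atLeast (suc k) zero    = 0
  atLeast (suc k) (suc i) = atLeast k i

  atLeast-mono : ∀ k {i j} → i ≤ j → atLeast k i ≤ atLeast k j
  atLeast-mono zero    _         = ≤-refl
  atLeast-mono (suc k) {zero}  _ = z≤n
  atLeast-mono (suc k) {suc i} {suc j} (s≤s i≤j) = atLeast-mono k i≤j

  suffixSums≤⇒≼ : ∀ {n} (α β : Vec ℕ n) →
    (∀ k → ∑[ i < n ] (atLeast k (toℕ i) * lookup α i) ≤ ∑[ i < n ] (atLeast k (toℕ i) * lookup β i)) → α ≼ β
  suffixSums≤⇒≼ []      []      _  = tt
  suffixSums≤⇒≼ (x ∷ α) (y ∷ β) le =
    subst₂ _≤_ (total x α) (total y β) (le 0) , suffixSums≤⇒≼ α β (le ∘ suc)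
    where
    total : ∀ {n} x (α : Vec ℕ n) → 1 * x + ∑[ i < n ] (1 * lookup α i) ≡ x + Vec.sum α
    total x α = cong₂ _+_ (*-identityˡ x) (trans (sum-cong-≗ (λ i → *-identityˡ (lookup α i))) (sym (sum≡∑-lookup α)))

  upper⇒≼ : ∀ {n} {α β : Vec ℕ n} {f : Coupling n} → IsCoupling α β f → Upper f → α ≼ β
  upper⇒≼ {α = α} {β} coupling upper =
    suffixSums≤⇒≼ α β (λ k → upper⇒∑-mono-≤ coupling upper (atLeast k ∘ toℕ) (atLeast-mono k))

  incrementAt : ∀ {n} → Vec ℕ n → Fin n → Vec ℕ n
  incrementAt (x ∷ α) Fin.zero    = suc x ∷ α
  incrementAt (x ∷ α) (Fin.suc i) = x ∷ incrementAt α i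

  sum-incrementAt : ∀ {n} (α : Vec ℕ n) i → Vec.sum (incrementAt α i) ≡ suc (Vec.sum α)
  sum-incrementAt (x ∷ α) Fin.zero    = refl
  sum-incrementAt (x ∷ α) (Fin.suc i) = trans (cong (x +_) (sum-incrementAt α i)) (+-suc x (Vec.sum α))

  δ : ∀ {n} → Fin n → Fin n → ℕ
  δ Fin.zero    Fin.zero    = 1
  δ Fin.zero    (Fin.suc _) = 0
  δ (Fin.suc _) Fin.zero    = 0
  δ (Fin.suc i) (Fin.suc j) = δ i j

  δ≡0⊎≡ : ∀ {n} (i j : Fin n) → δ i j ≡ 0 ⊎ i ≡ j
  δ≡0⊎≡ Fin.zero    Fin.zero    = inj₂ refl
  δ≡0⊎≡ Fin.zero    (Fin.suc _) = inj₁ refl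
  δ≡0⊎≡ (Fin.suc _) Fin.zero    = inj₁ refl
  δ≡0⊎≡ (Fin.suc i) (Fin.suc j) with δ≡0⊎≡ i j
  ... | inj₁ δij≡0 = inj₁ δij≡0
  ... | inj₂ i≡j   = inj₂ (cong Fin.suc i≡j)

  ∑-δ : ∀ {n} (j : Fin n) → ∑[ i < n ] δ i j ≡ 1
  ∑-δ {suc n} Fin.zero = cong suc (≡0⇒∑≡0 {n} (λ _ → refl))
  ∑-δ (Fin.suc j) = ∑-δ j

  lookup-incrementAt : ∀ {n} (α : Vec ℕ n) i r → lookup (incrementAt α i) r ≡ lookup α r + δ r i
  lookup-incrementAt (x ∷ α) Fin.zero    Fin.zero    = +-comm 1 x
  lookup-incrementAt (x ∷ α) Fin.zero    (Fin.suc r) = sym (+-identityʳ _)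
  lookup-incrementAt (x ∷ α) (Fin.suc i) Fin.zero    = sym (+-identityʳ x)
  lookup-incrementAt (x ∷ α) (Fin.suc i) (Fin.suc r) = lookup-incrementAt α i r

  isCoupling-addUnit : ∀ {n} {α β : Vec ℕ n} {f : Coupling n} i j → IsCoupling α β f →
    IsCoupling (incrementAt α i) (incrementAt β j) (λ a b → f a b + δ a i * δ b j)
  isCoupling-addUnit {n} {α} {β} {f} i j (isCoupling rowSums colSums) = isCoupling rowSums′ colSums′
    where
    open ≡-Reasoning
    rowSums′ : ∀ a → lookup (incrementAt α i) a ≡ ∑[ b < n ] (f a b + δ a i * δ b j)
    rowSums′ a = begin
      lookup (incrementAt α i) a                         ≡⟨ lookup-incrementAt α i a ⟩
      lookup α a + δ a i                                 ≡⟨ cong₂ _+_ (rowSums a) (sym (*-identityʳ (δ a i))) ⟩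
      ∑[ b < n ] f a b + δ a i * 1                       ≡⟨ cong (λ m → _ + δ a i * m) (∑-δ j) ⟨
      ∑[ b < n ] f a b + δ a i * ∑[ b < n ] δ b j        ≡⟨ cong (_ +_) (*-distribˡ-sum (δ a i) (λ b → δ b j)) ⟩
      ∑[ b < n ] f a b + ∑[ b < n ] (δ a i * δ b j)      ≡⟨ ∑-distrib-+ (f a) (λ b → δ a i * δ b j) ⟨
      ∑[ b < n ] (f a b + δ a i * δ b j)                 ∎
    colSums′ : ∀ b → lookup (incrementAt β j) b ≡ ∑[ a < n ] (f a b + δ a i * δ b j)
    colSums′ b = begin
      lookup (incrementAt β j) b                         ≡⟨ lookup-incrementAt β j b ⟩
      lookup β b + δ b j                                 ≡⟨ cong₂ _+_ (colSums b) (sym (*-identityˡ (δ b j))) ⟩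
      ∑[ a < n ] f a b + 1 * δ b j                       ≡⟨ cong (λ m → _ + m * δ b j) (∑-δ i) ⟨
      ∑[ a < n ] f a b + ∑[ a < n ] δ a i * δ b j        ≡⟨ cong (_ +_) (*-distribʳ-sum (δ b j) (λ a → δ a i)) ⟩
      ∑[ a < n ] f a b + ∑[ a < n ] (δ a i * δ b j)      ≡⟨ ∑-distrib-+ (λ a → f a b) (λ a → δ a i * δ b j) ⟨
      ∑[ a < n ] (f a b + δ a i * δ b j)                 ∎

  upper-addUnit : ∀ {n} {f : Coupling n} {i j : Fin n} → toℕ i ≤ toℕ j → Upper f →
    Upper (λ a b → f a b + δ a i * δ b j)
  upper-addUnit {f = f} {i} {j} i≤j upper a b b<a with δ≡0⊎≡ a i | δ≡0⊎≡ b j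
  ... | inj₁ δai≡0 | _          rewrite δai≡0 = trans (+-identityʳ _) (upper a b b<a)
  ... | inj₂ _     | inj₁ δbj≡0 rewrite δbj≡0 | *-zeroʳ (δ a i) = trans (+-identityʳ _) (upper a b b<a)
  ... | inj₂ refl  | inj₂ refl  = ⊥-elim (<⇒≱ b<a i≤j)

  peelRight : ∀ {n} (α β : Vec ℕ n) → α ≼ β → Vec.sum α < Vec.sum β →
    Σ (Fin n) λ j → Σ (Vec ℕ n) λ β′ → β ≡ incrementAt β′ j × α ≼ β′
  peelRight (x ∷ α) (suc y ∷ β) (_ , α≼β) lt = Fin.zero , y ∷ β , refl , ≤-pred lt , α≼β
  peelRight (x ∷ α) (zero ∷ β)  (_ , α≼β) lt
    with peelRight α β α≼β (<-≤-trans (s≤s (m≤n+m (Vec.sum α) x)) lt)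
  ... | j , β′ , refl , α≼β′ =
    Fin.suc j , zero ∷ β′ , refl , ≤-pred (subst (x + Vec.sum α <_) (sum-incrementAt β′ j) lt) , α≼β′

  record Peeling {n} (α β : Vec ℕ n) : Set where
    field
      i j   : Fin n
      i≤j   : toℕ i ≤ toℕ j
      α′ β′ : Vec ℕ n
      α≡    : α ≡ incrementAt α′ i
      β≡    : β ≡ incrementAt β′ j
      α′≼β′ : α′ ≼ β′

  -- Pair the leftmost unit of α with the leftmost unit of β, which α ≼ β places at or to its right.
  peel : ∀ {n} s (α β : Vec ℕ n) → Vec.sum α ≡ suc s → Vec.sum β ≡ suc s → α ≼ β → Peeling α β
  peel s (suc x ∷ α) (suc y ∷ β) _ _ (le , α≼β) =
    record { i = Fin.zero ; j = Fin.zero ; i≤j = z≤n ; α≡ = refl ; β≡ = refl ; α′≼β′ = ≤-pred le , α≼β }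
  peel s (suc x ∷ α) (zero ∷ β) _ _ (le , α≼β)
    with peelRight α β α≼β (<-≤-trans (s≤s (m≤n+m (Vec.sum α) x)) le)
  ... | j , β′ , refl , α≼β′ = record
    { i = Fin.zero ; j = Fin.suc j ; i≤j = z≤n ; α≡ = refl ; β≡ = refl
    ; α′≼β′ = ≤-pred (subst (suc x + Vec.sum α ≤_) (sum-incrementAt β′ j) le) , α≼β′ }
  peel s (zero ∷ α) (suc y ∷ β) sumα sumβ (_ , α≼β) =
    ⊥-elim (<⇒≱ (≤-trans (s≤s (m≤n+m (Vec.sum β) y)) (≤-reflexive (trans sumβ (sym sumα)))) (≼⇒sum≤ α β α≼β))
  peel s (zero ∷ α) (zero ∷ β) sumα sumβ (le , α≼β) with peel s α β sumα sumβ α≼β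
  ... | record { i = i ; j = j ; i≤j = i≤j ; α′ = α′ ; β′ = β′ ; α≡ = refl ; β≡ = refl ; α′≼β′ = α′≼β′ } = record
    { i = Fin.suc i ; j = Fin.suc j ; i≤j = s≤s i≤j ; α≡ = refl ; β≡ = refl
    ; α′≼β′ = ≤-reflexive (suc-injective (trans (sym (sum-incrementAt α′ i))
                            (trans sumα (trans (sym sumβ) (sum-incrementAt β′ j))))) , α′≼β′ }

  ≼⇒upperCoupling : ∀ s {n} (α β : Vec ℕ n) → Vec.sum α ≡ s → Vec.sum β ≡ s → α ≼ β →
    Σ (Coupling n) λ f → IsCoupling α β f × Upper f
  ≼⇒upperCoupling zero {n} α β sumα sumβ _ =
    (λ _ _ → 0) , isCoupling (λ i → trans (empty α sumα i) (sym (≡0⇒∑≡0 {n} λ _ → refl)))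
                             (λ j → trans (empty β sumβ j) (sym (≡0⇒∑≡0 {n} λ _ → refl))) , (λ _ _ _ → refl)
    where
    empty : ∀ {n} (γ : Vec ℕ n) → Vec.sum γ ≡ 0 → ∀ i → lookup γ i ≡ 0
    empty γ eq = ∑≡0⇒≡0 (lookup γ) (trans (sym (sum≡∑-lookup γ)) eq)
  ≼⇒upperCoupling (suc s) α β sumα sumβ α≼β with peel s α β sumα sumβ α≼β
  ... | record { i = i ; j = j ; i≤j = i≤j ; α′ = α′ ; β′ = β′ ; α≡ = refl ; β≡ = refl ; α′≼β′ = α′≼β′ }
    with ≼⇒upperCoupling s α′ β′ (suc-injective (trans (sym (sum-incrementAt α′ i)) sumα))
                                (suc-injective (trans (sym (sum-incrementAt β′ j)) sumβ)) α′≼β′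
  ... | f , coupling , upper = _ , isCoupling-addUnit i j coupling , upper-addUnit i≤j upper

  comparable⇒optimalCoupling : ∀ s {n} (α β : Vec ℕ n) → Vec.sum α ≡ s → Vec.sum β ≡ s → α ≼ β ⊎ β ≼ α →
    Σ (Coupling n) λ f → IsCoupling α β f × transportCost distance f ≡ ℤ.∣ 𝒟 α β ∣
  comparable⇒optimalCoupling s α β sumα sumβ (inj₁ α≼β) with ≼⇒upperCoupling s α β sumα sumβ α≼β
  ... | f , coupling , upper =
    f , coupling , from (transportCost≡∣𝒟∣⇔ coupling) (inj₂ (from (leftward≡0⇔upper f) upper))
  comparable⇒optimalCoupling s α β sumα sumβ (inj₂ β≼α) with ≼⇒upperCoupling s β α sumβ sumα β≼α
  ... | g , coupling , upper =
    flip g , transpose-isCoupling coupling ,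
    from (transportCost≡∣𝒟∣⇔ (transpose-isCoupling coupling)) (inj₁ (from (rightward≡0⇔upper-flip (flip g)) upper))

  optimalCoupling⇒comparable : ∀ {n} {α β : Vec ℕ n} {f : Coupling n} → IsCoupling α β f →
    transportCost distance f ≡ ℤ.∣ 𝒟 α β ∣ → α ≼ β ⊎ β ≼ α
  optimalCoupling⇒comparable {f = f} coupling cost≡ with to (transportCost≡∣𝒟∣⇔ coupling) cost≡
  ... | inj₁ R≡0 = inj₂ (upper⇒≼ (transpose-isCoupling coupling) (to (rightward≡0⇔upper-flip f) R≡0))
  ... | inj₂ L≡0 = inj₁ (upper⇒≼ coupling (to (leftward≡0⇔upper f) L≡0))

  isEMC⇔comparable : ∀ s {n} (α β : Vec ℕ n) → Vec.sum α ≡ s → Vec.sum β ≡ s →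
    IsEMC α β ℤ.∣ 𝒟 α β ∣ ⇔ (α ≼ β ⊎ β ≼ α)
  isEMC⇔comparable s α β sumα sumβ = mk⇔ optimal⇒comparable comparable⇒optimal
    where
    optimal⇒comparable : IsEMC α β ℤ.∣ 𝒟 α β ∣ → α ≼ β ⊎ β ≼ α
    optimal⇒comparable ((J , plan , cost≡) , _) =
      optimalCoupling⇒comparable (isPlan⇒isCoupling J plan) (trans (sym (cost≡transportCost J)) cost≡)
    comparable⇒optimal : α ≼ β ⊎ β ≼ α → IsEMC α β ℤ.∣ 𝒟 α β ∣
    comparable⇒optimal comparable with comparable⇒optimalCoupling s α β sumα sumβ comparable
    ... | f , coupling , cost≡ =
      (matrix f , isCoupling⇒isPlan f coupling ,
        trans (cost≡transportCost (matrix f)) (trans (transportCost-congʳ distance (entry-matrix f)) cost≡)) ,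
      λ J plan →
        subst (ℤ.∣ 𝒟 α β ∣ ≤_) (sym (cost≡transportCost J)) (∣𝒟∣≤transportCost (isPlan⇒isCoupling J plan))

module Enumeration where

  open Transport using (_≼_; ≼-refl; ≼-antisym)
  open import Data.Nat using (ℕ; zero; suc; _+_; _≤_; _<_; _≤?_; _≟_)
  open import Data.Nat.Properties using (suc-injective; <⇒≱; +-suc; +-comm; +-assoc)
  import Data.Vec.Properties as Vec
  open import Data.List using (_∷_; []; _++_; map; [_]; filter)
  open import Data.List.Properties using (length-++; length-map)
  open import Data.List.Membership.Propositional.Properties
    using (∈-map⁺; ∈-map⁻; ∈-++⁺ˡ; ∈-++⁺ʳ; ∈-++⁻; ∈-filter⁺; ∈-filter⁻)
  open import Data.List.Membership.Propositional.Properties.WithK using (unique∧set⇒bag)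
  open import Data.List.Relation.Binary.BagAndSetEquality using (∼bag⇒↭)
  open import Data.List.Relation.Binary.Permutation.Propositional.Properties using (↭-length)
  open import Data.List.Relation.Unary.Any using (here)
  open import Data.List.Relation.Unary.AllPairs using ([]; _∷_)
  import Data.List.Relation.Unary.All as All
  import Data.List.Relation.Unary.Unique.Propositional.Properties as Unique
  open import Data.Unit using (tt)
  open import Relation.Nullary using (yes; no; ¬_; ¬?)
  open import Relation.Unary using (Decidable)

  incrementHead : ∀ {n} → Vec ℕ (suc n) → Vec ℕ (suc n)
  incrementHead (x ∷ α) = suc x ∷ α

  incrementHead-injective : ∀ {n} {α β : Vec ℕ (suc n)} → incrementHead α ≡ incrementHead β → α ≡ β
  incrementHead-injective {α = _ ∷ _} {_ ∷ _} refl = refl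

  compositions : (n s : ℕ) → List (Vec ℕ n)
  compositions zero    zero    = [ [] ]
  compositions zero    (suc s) = []
  compositions (suc n) zero    = map (0 ∷_) (compositions n zero)
  compositions (suc n) (suc s) = map (0 ∷_) (compositions n (suc s)) ++ map incrementHead (compositions (suc n) s)

  ∈compositions⇒ : ∀ n s (α : Vec ℕ n) → α ∈ compositions n s → Vec.sum α ≡ s
  ∈compositions⇒ zero    zero    [] _ = refl
  ∈compositions⇒ (suc n) zero    α α∈ with ∈-map⁻ (0 ∷_) α∈
  ... | α′ , α′∈ , refl = ∈compositions⇒ n zero α′ α′∈
  ∈compositions⇒ (suc n) (suc s) α α∈ with ∈-++⁻ (map (0 ∷_) (compositions n (suc s))) α∈
  ... | inj₁ α∈₁ with ∈-map⁻ (0 ∷_) α∈₁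
  ...   | α′ , α′∈ , refl = ∈compositions⇒ n (suc s) α′ α′∈
  ∈compositions⇒ (suc n) (suc s) α α∈ | inj₂ α∈₂ with ∈-map⁻ incrementHead α∈₂
  ...   | x ∷ α′ , α′∈ , refl = cong suc (∈compositions⇒ (suc n) s (x ∷ α′) α′∈)

  ⇒∈compositions : ∀ n s (α : Vec ℕ n) → Vec.sum α ≡ s → α ∈ compositions n s
  ⇒∈compositions zero    zero    []          _   = here refl
  ⇒∈compositions (suc n) zero    (zero ∷ α)  eq  = ∈-map⁺ (0 ∷_) (⇒∈compositions n zero α eq)
  ⇒∈compositions (suc n) (suc s) (zero ∷ α)  eq  = ∈-++⁺ˡ (∈-map⁺ (0 ∷_) (⇒∈compositions n (suc s) α eq))
  ⇒∈compositions (suc n) (suc s) (suc x ∷ α) eq  =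
    ∈-++⁺ʳ _ (∈-map⁺ incrementHead (⇒∈compositions (suc n) s (x ∷ α) (suc-injective eq)))

  ∈compositions⇔ : ∀ n s (α : Vec ℕ n) → α ∈ compositions n s ⇔ Vec.sum α ≡ s
  ∈compositions⇔ n s α = mk⇔ (∈compositions⇒ n s α) (⇒∈compositions n s α)

  compositions-unique : ∀ n s → Unique (compositions n s)
  compositions-unique zero    zero    = All.[] ∷ []
  compositions-unique zero    (suc s) = []
  compositions-unique (suc n) zero    = Unique.map⁺ Vec.∷-injectiveʳ (compositions-unique n zero)
  compositions-unique (suc n) (suc s) =
    Unique.++⁺ (Unique.map⁺ Vec.∷-injectiveʳ (compositions-unique n (suc s)))
               (Unique.map⁺ incrementHead-injective (compositions-unique (suc n) s)) disjoint
    where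
    disjoint : ∀ {α} → ¬ (α ∈ map (0 ∷_) (compositions n (suc s)) × α ∈ map incrementHead (compositions (suc n) s))
    disjoint (α∈₁ , α∈₂) with ∈-map⁻ (0 ∷_) α∈₁ | ∈-map⁻ incrementHead α∈₂
    ... | _ , _ , refl | _ ∷ _ , _ , ()

  length-compositions-suc : ∀ n s →
    length (compositions (suc n) (suc s)) ≡ length (compositions n (suc s)) + length (compositions (suc n) s)
  length-compositions-suc n s =
    trans (length-++ (map (0 ∷_) (compositions n (suc s))))
          (cong₂ _+_ (length-map (0 ∷_) (compositions n (suc s))) (length-map incrementHead (compositions (suc n) s)))

  Pair : ℕ → Set
  Pair n = Vec ℕ n × Vec ℕ n

  DominatedWithSums : ∀ {n} → ℕ → ℕ → Pair n → Set
  DominatedWithSums a b (α , β) = Vec.sum α ≡ a × Vec.sum β ≡ b × α ≼ β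

  Enumerates : ∀ {n} → (ℕ → ℕ → List (Pair n)) → Set
  Enumerates {n} t = ∀ a b (p : Pair n) → p ∈ t a b ⇔ DominatedWithSums a b p

  cons₀ : ∀ {n} → Pair n → Pair (suc n)
  cons₀ (α , β) = 0 ∷ α , 0 ∷ β

  incrementFirst incrementSecond : ∀ {n} → Pair (suc n) → Pair (suc n)
  incrementFirst  (α , β) = incrementHead α , β
  incrementSecond (α , β) = α , incrementHead β

  cons₀-injective : ∀ {n} {p q : Pair n} → cons₀ p ≡ cons₀ q → p ≡ q
  cons₀-injective {p = _ , _} {_ , _} refl = refl

  incrementFirst-injective : ∀ {n} {p q : Pair (suc n)} → incrementFirst p ≡ incrementFirst q → p ≡ q
  incrementFirst-injective {p = _ ∷ _ , _} {_ ∷ _ , _} refl = refl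

  incrementSecond-injective : ∀ {n} {p q : Pair (suc n)} → incrementSecond p ≡ incrementSecond q → p ≡ q
  incrementSecond-injective {p = _ , _ ∷ _} {_ , _ ∷ _} refl = refl

  module _ {n} (t : ℕ → ℕ → List (Pair n)) where

    extendSecond : ℕ → ℕ → List (Pair (suc n))
    extendSecond a zero    = map cons₀ (t a zero)
    extendSecond a (suc b) = map cons₀ (t a (suc b)) ++ map incrementSecond (extendSecond a b)

    extend : ℕ → ℕ → List (Pair (suc n))
    extend zero    b = extendSecond zero b
    extend (suc a) b = extendSecond (suc a) b ++ map incrementFirst (extend a b)

    module _ (t-enumerates : Enumerates t) where

      ∈extendSecond⇒ : ∀ a b x α y β → (x ∷ α , y ∷ β) ∈ extendSecond a b →
        x ≡ 0 × Vec.sum α ≡ a × y + Vec.sum β ≡ b × α ≼ β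
      ∈extendSecond⇒ a zero x α y β p∈ with ∈-map⁻ cons₀ p∈
      ... | (α′ , β′) , p′∈ , refl = refl , to (t-enumerates a zero (α′ , β′)) p′∈
      ∈extendSecond⇒ a (suc b) x α y β p∈ with ∈-++⁻ (map cons₀ (t a (suc b))) p∈
      ... | inj₁ p∈₁ with ∈-map⁻ cons₀ p∈₁
      ...   | (α′ , β′) , p′∈ , refl = refl , to (t-enumerates a (suc b) (α′ , β′)) p′∈
      ∈extendSecond⇒ a (suc b) x α y β p∈ | inj₂ p∈₂ with ∈-map⁻ incrementSecond p∈₂
      ...   | (x′ ∷ α′ , y′ ∷ β′) , p′∈ , refl with ∈extendSecond⇒ a b x′ α′ y′ β′ p′∈
      ...     | x≡0 , sumα , sumβ , α≼β = x≡0 , sumα , cong suc sumβ , α≼β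

      ⇒∈extendSecond : ∀ a b α y β → Vec.sum α ≡ a → y + Vec.sum β ≡ b → α ≼ β →
        (0 ∷ α , y ∷ β) ∈ extendSecond a b
      ⇒∈extendSecond a zero    α zero    β sumα sumβ α≼β =
        ∈-map⁺ cons₀ (from (t-enumerates a zero (α , β)) (sumα , sumβ , α≼β))
      ⇒∈extendSecond a (suc b) α zero    β sumα sumβ α≼β =
        ∈-++⁺ˡ (∈-map⁺ cons₀ (from (t-enumerates a (suc b) (α , β)) (sumα , sumβ , α≼β)))
      ⇒∈extendSecond a (suc b) α (suc y) β sumα sumβ α≼β =
        ∈-++⁺ʳ _ (∈-map⁺ incrementSecond (⇒∈extendSecond a b α y β sumα (suc-injective sumβ) α≼β))

      ∈extend⇒ : ∀ a b x α y β → (x ∷ α , y ∷ β) ∈ extend a b →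
        x + Vec.sum α ≡ a × y + Vec.sum β ≡ b × α ≼ β
      ∈extend⇒ zero b x α y β p∈ with ∈extendSecond⇒ zero b x α y β p∈
      ... | refl , sums = sums
      ∈extend⇒ (suc a) b x α y β p∈ with ∈-++⁻ (extendSecond (suc a) b) p∈
      ... | inj₁ p∈₁ with ∈extendSecond⇒ (suc a) b x α y β p∈₁
      ...   | refl , sums = sums
      ∈extend⇒ (suc a) b x α y β p∈ | inj₂ p∈₂ with ∈-map⁻ incrementFirst p∈₂
      ...   | (x′ ∷ α′ , y′ ∷ β′) , p′∈ , refl with ∈extend⇒ a b x′ α′ y′ β′ p′∈
      ...     | sumα , sumβ , α≼β = cong suc sumα , sumβ , α≼β

      ⇒∈extend : ∀ a b x α y β → x + Vec.sum α ≡ a → y + Vec.sum β ≡ b → α ≼ β →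
        (x ∷ α , y ∷ β) ∈ extend a b
      ⇒∈extend zero    b zero    α y β sumα sumβ α≼β = ⇒∈extendSecond zero b α y β sumα sumβ α≼β
      ⇒∈extend (suc a) b zero    α y β sumα sumβ α≼β = ∈-++⁺ˡ (⇒∈extendSecond (suc a) b α y β sumα sumβ α≼β)
      ⇒∈extend (suc a) b (suc x) α y β sumα sumβ α≼β =
        ∈-++⁺ʳ _ (∈-map⁺ incrementFirst (⇒∈extend a b x α y β (suc-injective sumα) sumβ α≼β))

    module _ (t-unique : ∀ a b → Unique (t a b)) where

      extendSecond-unique : ∀ a b → Unique (extendSecond a b)
      extendSecond-unique a zero    = Unique.map⁺ cons₀-injective (t-unique a zero)
      extendSecond-unique a (suc b) =
        Unique.++⁺ (Unique.map⁺ cons₀-injective (t-unique a (suc b)))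
                   (Unique.map⁺ incrementSecond-injective (extendSecond-unique a b)) disjoint
        where
        disjoint : ∀ {p} → ¬ (p ∈ map cons₀ (t a (suc b)) × p ∈ map incrementSecond (extendSecond a b))
        disjoint (p∈₁ , p∈₂) with ∈-map⁻ cons₀ p∈₁ | ∈-map⁻ incrementSecond p∈₂
        ... | _ , _ , refl | (_ , _ ∷ _) , _ , ()

      extend-unique : Enumerates t → ∀ a b → Unique (extend a b)
      extend-unique t-enumerates zero    b = extendSecond-unique zero b
      extend-unique t-enumerates (suc a) b =
        Unique.++⁺ (extendSecond-unique (suc a) b)
                   (Unique.map⁺ incrementFirst-injective (extend-unique t-enumerates a b)) disjoint
        where
        disjoint : ∀ {p} → ¬ (p ∈ extendSecond (suc a) b × p ∈ map incrementFirst (extend a b))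
        disjoint (p∈₁ , p∈₂) with ∈-map⁻ incrementFirst p∈₂
        ... | (x ∷ α , y ∷ β) , _ , refl with ∈extendSecond⇒ t-enumerates (suc a) b (suc x) α y β p∈₁
        ...   | () , _

    length-extendSecond-suc : ∀ a b →
      length (extendSecond a (suc b)) ≡ length (t a (suc b)) + length (extendSecond a b)
    length-extendSecond-suc a b = trans (length-++ (map cons₀ (t a (suc b))))
      (cong₂ _+_ (length-map cons₀ (t a (suc b))) (length-map incrementSecond (extendSecond a b)))

    length-extend-suc : ∀ a b → length (extend (suc a) b) ≡ length (extendSecond (suc a) b) + length (extend a b)
    length-extend-suc a b =
      trans (length-++ (extendSecond (suc a) b)) (cong (length (extendSecond (suc a) b) +_) (length-map incrementFirst (extend a b)))

  dominatedPairs : (n a b : ℕ) → List (Pair n)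
  dominatedPairs zero    zero    zero    = [ ([] , []) ]
  dominatedPairs zero    zero    (suc b) = []
  dominatedPairs zero    (suc a) b       = []
  dominatedPairs (suc n) a       b       with a ≤? b
  ... | yes _ = extend (dominatedPairs n) a b
  ... | no  _ = []

  dominatedPairs-enumerates : ∀ n → Enumerates (dominatedPairs n)
  dominatedPairs-enumerates zero    zero    zero    ([] , []) = mk⇔ (λ _ → refl , refl , tt) (λ _ → here refl)
  dominatedPairs-enumerates zero    zero    (suc b) ([] , []) = mk⇔ (λ ()) (λ { (_ , () , _) })
  dominatedPairs-enumerates zero    (suc a) b       ([] , []) = mk⇔ (λ ()) (λ { (() , _ , _) })
  dominatedPairs-enumerates (suc n) a       b       (x ∷ α , y ∷ β) with a ≤? b
  ... | yes a≤b = mk⇔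
    (λ p∈ → let (sumα , sumβ , α≼β) = ∈extend⇒ (dominatedPairs n) (dominatedPairs-enumerates n) a b x α y β p∈
            in sumα , sumβ , subst₂ _≤_ (sym sumα) (sym sumβ) a≤b , α≼β)
    (λ { (sumα , sumβ , _ , α≼β) →
           ⇒∈extend (dominatedPairs n) (dominatedPairs-enumerates n) a b x α y β sumα sumβ α≼β })
  ... | no a≰b = mk⇔ (λ ()) (λ { (sumα , sumβ , le , _) → ⊥-elim (a≰b (subst₂ _≤_ sumα sumβ le)) })

  dominatedPairs-unique : ∀ n a b → Unique (dominatedPairs n a b)
  dominatedPairs-unique zero    zero    zero    = All.[] ∷ []
  dominatedPairs-unique zero    zero    (suc b) = []
  dominatedPairs-unique zero    (suc a) b       = []
  dominatedPairs-unique (suc n) a       b       with a ≤? b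
  ... | yes _ = extend-unique (dominatedPairs n) (dominatedPairs-unique n) (dominatedPairs-enumerates n) a b
  ... | no  _ = []

  length-dominatedPairs-≤ : ∀ n {a b} → a ≤ b → length (dominatedPairs (suc n) a b) ≡ length (extend (dominatedPairs n) a b)
  length-dominatedPairs-≤ n {a} {b} a≤b with a ≤? b
  ... | yes _   = refl
  ... | no  a≰b = ⊥-elim (a≰b a≤b)

  length-dominatedPairs-> : ∀ n {a b} → b < a → length (dominatedPairs (suc n) a b) ≡ 0
  length-dominatedPairs-> n {a} {b} b<a with a ≤? b
  ... | yes a≤b = ⊥-elim (<⇒≱ b<a a≤b)
  ... | no  _   = refl

  unique∧sameMembers⇒length≡ : ∀ {A : Set} {xs ys : List A} → Unique xs → Unique ys →
    (∀ x → x ∈ xs ⇔ x ∈ ys) → length xs ≡ length ys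
  unique∧sameMembers⇒length≡ xs! ys! same = ↭-length (∼bag⇒↭ (unique∧set⇒bag xs! ys! (λ {x} → same x)))

  length-filter+length-filter-¬ : ∀ {A : Set} {P : A → Set} (P? : Decidable P) (xs : List A) →
    length (filter P? xs) + length (filter (λ x → ¬? (P? x)) xs) ≡ length xs
  length-filter+length-filter-¬ P? []       = refl
  length-filter+length-filter-¬ P? (x ∷ xs) with P? x
  ... | yes _ = cong suc (length-filter+length-filter-¬ P? xs)
  ... | no  _ = trans (+-suc _ _) (cong suc (length-filter+length-filter-¬ P? xs))

  module _ (n s : ℕ) where

    private
      dominated = dominatedPairs n s s

      diagonal? : Decidable (λ (p : Pair n) → proj₁ p ≡ proj₂ p)
      diagonal? (α , β) = Vec.≡-dec _≟_ α β

      offDiagonal? : Decidable (λ (p : Pair n) → ¬ proj₁ p ≡ proj₂ p)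
      offDiagonal? p = ¬? (diagonal? p)

      ∈dominated⇔ : ∀ α β → (α , β) ∈ dominated ⇔ DominatedWithSums s s (α , β)
      ∈dominated⇔ α β = dominatedPairs-enumerates n s s (α , β)

    comparablePairs : List (Pair n)
    comparablePairs = dominated ++ map swap (filter offDiagonal? dominated)

    ∈comparablePairs⇔ : ∀ α β →
      (α , β) ∈ comparablePairs ⇔ (Vec.sum α ≡ s × Vec.sum β ≡ s × (α ≼ β ⊎ β ≼ α))
    ∈comparablePairs⇔ α β = mk⇔ ∈⇒ ⇒∈
      where
      ∈⇒ : (α , β) ∈ comparablePairs → Vec.sum α ≡ s × Vec.sum β ≡ s × (α ≼ β ⊎ β ≼ α)
      ∈⇒ p∈ with ∈-++⁻ dominated p∈
      ... | inj₁ p∈₁ = let (sumα , sumβ , α≼β) = to (∈dominated⇔ α β) p∈₁ in sumα , sumβ , inj₁ α≼β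
      ... | inj₂ p∈₂ with ∈-map⁻ swap p∈₂
      ...   | (β′ , α′) , p′∈ , refl =
        let (sumβ , sumα , β≼α) = to (∈dominated⇔ β′ α′) (proj₁ (∈-filter⁻ offDiagonal? p′∈))
        in sumα , sumβ , inj₂ β≼α
      ⇒∈ : Vec.sum α ≡ s × Vec.sum β ≡ s × (α ≼ β ⊎ β ≼ α) → (α , β) ∈ comparablePairs
      ⇒∈ (sumα , sumβ , inj₁ α≼β) = ∈-++⁺ˡ (from (∈dominated⇔ α β) (sumα , sumβ , α≼β))
      ⇒∈ (sumα , sumβ , inj₂ β≼α) with Vec.≡-dec _≟_ β α
      ... | yes refl = ∈-++⁺ˡ (from (∈dominated⇔ α α) (sumα , sumβ , β≼α))
      ... | no  β≢α  =
        ∈-++⁺ʳ dominated (∈-map⁺ swap (∈-filter⁺ offDiagonal? (from (∈dominated⇔ β α) (sumβ , sumα , β≼α)) β≢α))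

    comparablePairs-unique : Unique comparablePairs
    comparablePairs-unique =
      Unique.++⁺ (dominatedPairs-unique n s s)
                 (Unique.map⁺ swap-injective (Unique.filter⁺ offDiagonal? (dominatedPairs-unique n s s))) disjoint
      where
      swap-injective : ∀ {p q : Pair n} → swap p ≡ swap q → p ≡ q
      swap-injective {_ , _} {_ , _} refl = refl
      disjoint : ∀ {p} → ¬ (p ∈ dominated × p ∈ map swap (filter offDiagonal? dominated))
      disjoint {α , β} (p∈₁ , p∈₂) with ∈-map⁻ swap p∈₂
      ... | (β , α) , p′∈ , refl with ∈-filter⁻ offDiagonal? p′∈
      ...   | p′∈′ , β≢α = β≢α (≼-antisym β α (proj₂ (proj₂ (to (∈dominated⇔ β α) p′∈′)))
                                               (proj₂ (proj₂ (to (∈dominated⇔ α β) p∈₁))))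

    length-diagonal : length (filter diagonal? dominated) ≡ length (compositions n s)
    length-diagonal = trans
      (unique∧sameMembers⇒length≡ (Unique.filter⁺ diagonal? (dominatedPairs-unique n s s))
                                  (Unique.map⁺ double-injective (compositions-unique n s)) same)
      (length-map double (compositions n s))
      where
      double : Vec ℕ n → Pair n
      double α = α , α
      double-injective : ∀ {α β} → double α ≡ double β → α ≡ β
      double-injective refl = refl
      same : ∀ p → p ∈ filter diagonal? dominated ⇔ p ∈ map double (compositions n s)
      same (α , β) = mk⇔ ∈⇒ ⇒∈
        where
        ∈⇒ : (α , β) ∈ filter diagonal? dominated → (α , β) ∈ map double (compositions n s)
        ∈⇒ p∈ with ∈-filter⁻ diagonal? p∈
        ... | p∈′ , refl = ∈-map⁺ double (from (∈compositions⇔ n s α) (proj₁ (to (∈dominated⇔ α α) p∈′)))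
        ⇒∈ : (α , β) ∈ map double (compositions n s) → (α , β) ∈ filter diagonal? dominated
        ⇒∈ p∈ with ∈-map⁻ double p∈
        ... | γ , γ∈ , refl = ∈-filter⁺ diagonal? (from (∈dominated⇔ γ γ) (sumγ , sumγ , ≼-refl γ)) refl
          where sumγ = to (∈compositions⇔ n s γ) γ∈

    length-comparablePairs : length comparablePairs + length (compositions n s) ≡ length dominated + length dominated
    length-comparablePairs = begin
      length comparablePairs + length (compositions n s)
        ≡⟨ cong₂ _+_ (trans (length-++ dominated) (cong (length dominated +_) (length-map swap (filter offDiagonal? dominated))))
                     (sym length-diagonal) ⟩
      length dominated + length (filter offDiagonal? dominated) + length (filter diagonal? dominated)
        ≡⟨ +-assoc (length dominated) _ _ ⟩
      length dominated + (length (filter offDiagonal? dominated) + length (filter diagonal? dominated))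
        ≡⟨ cong (length dominated +_) (trans (+-comm (length (filter offDiagonal? dominated)) _)
                                             (length-filter+length-filter-¬ diagonal? dominated)) ⟩
      length dominated + length dominated ∎
      where open ≡-Reasoning

module BinomialCounts where

  open Enumeration using (compositions; length-compositions-suc; dominatedPairs; cons₀; extend; extendSecond;
    length-extendSecond-suc; length-extend-suc; length-dominatedPairs-≤; length-dominatedPairs->)
  open import Data.Nat as ℕ using (ℕ; zero; suc; _≤_; _<_; z≤n; s≤s; _!)
  import Data.Nat.Properties as ℕ
  open import Data.Integer using (ℤ; +_; -[1+_]; _+_; _*_; _-_)
  import Data.Integer.Properties as ℤ
  open import Data.Integer.Tactic.RingSolver using (solve-∀)
  open import Data.List.Properties using (length-map)

  -- Extended by zero to negative lower indices, so that Pascal's rule holds for every k.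
  binomial : ℕ → ℤ → ℤ
  binomial n       -[1+ k ]  = + 0
  binomial zero    (+ zero)  = + 1
  binomial zero    (+ suc k) = + 0
  binomial (suc n) (+ zero)  = + 1
  binomial (suc n) (+ suc k) = binomial n (+ suc k) + binomial n (+ k)

  binomial-pascal : ∀ n k → binomial (suc n) k ≡ binomial n k + binomial n (k - + 1)
  binomial-pascal n       -[1+ k ]  = refl
  binomial-pascal zero    (+ zero)  = refl
  binomial-pascal (suc n) (+ zero)  = refl
  binomial-pascal n       (+ suc k) = refl

  binomial-zero : ∀ n → binomial n (+ 0) ≡ + 1
  binomial-zero zero    = refl
  binomial-zero (suc n) = refl

  binomial-> : ∀ n k → n ℕ.< k → binomial n (+ k) ≡ + 0
  binomial-> zero    (suc k) _           = refl
  binomial-> (suc n) (suc k) (ℕ.s≤s n<k) = cong₂ _+_ (binomial-> n (suc k) (ℕ.m<n⇒m<1+n n<k)) (binomial-> n k n<k)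

  binomial-diag : ∀ n → binomial n (+ n) ≡ + 1
  binomial-diag zero    = refl
  binomial-diag (suc n) = cong₂ _+_ (binomial-> n (suc n) (ℕ.n<1+n n)) (binomial-diag n)

  binomial-absorption : ∀ n k → (k + + 1) * binomial n (k + + 1) ≡ (+ n - k) * binomial n k
  binomial-absorption zero (+ zero)      = refl
  binomial-absorption zero (+ suc k)     = trans (ℤ.*-zeroʳ (+ suc (k ℕ.+ 1))) (sym (ℤ.*-zeroʳ (+ 0 - + suc k)))
  binomial-absorption zero -[1+ zero ]   = refl
  binomial-absorption zero -[1+ suc k ]  = trans (ℤ.*-zeroʳ -[1+ k ]) (sym (ℤ.*-zeroʳ (+ 0 - -[1+ suc k ])))
  binomial-absorption (suc n) k = begin
    (k + + 1) * binomial (suc n) (k + + 1)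
      ≡⟨ cong ((k + + 1) *_) (trans (binomial-pascal n (k + + 1))
                                    (cong (λ i → binomial n (k + + 1) + binomial n i) (k+1-1≡k k))) ⟩
    (k + + 1) * (binomial n (k + + 1) + binomial n k)
      ≡⟨ split k (binomial n (k + + 1)) (binomial n k) ⟩
    (k + + 1) * binomial n (k + + 1) + k * binomial n k + binomial n k
      ≡⟨ cong₂ (λ x y → x + y + binomial n k) (binomial-absorption n k) below ⟩
    (+ n - k) * binomial n k + (+ n - k + + 1) * binomial n (k - + 1) + binomial n k
      ≡⟨ merge k (+ n) (binomial n k) (binomial n (k - + 1)) ⟩
    (+ n + + 1 - k) * (binomial n k + binomial n (k - + 1))
      ≡⟨ cong₂ (λ m b → (m - k) * b) (cong +_ (ℕ.+-comm n 1)) (sym (binomial-pascal n k)) ⟩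
    (+ suc n - k) * binomial (suc n) k ∎
    where
    open ≡-Reasoning
    k+1-1≡k : ∀ k → k + + 1 - + 1 ≡ k
    k+1-1≡k = solve-∀
    split : ∀ k A B → (k + + 1) * (A + B) ≡ (k + + 1) * A + k * B + B
    split = solve-∀
    merge : ∀ k n B C → (n - k) * B + (n - k + + 1) * C + B ≡ (n + + 1 - k) * (B + C)
    merge = solve-∀
    below : k * binomial n k ≡ (+ n - k + + 1) * binomial n (k - + 1)
    below = trans (cong (λ i → i * binomial n i) (sym (k-1+1≡k k)))
                  (trans (binomial-absorption n (k - + 1)) (cong (_* binomial n (k - + 1)) (shift (+ n) k)))
      where
      k-1+1≡k : ∀ k → k - + 1 + + 1 ≡ k
      k-1+1≡k = solve-∀
      shift : ∀ n k → n - (k - + 1) ≡ n - k + + 1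
      shift = solve-∀

  dominatedCount : ℕ → ℕ → ℕ → ℤ
  dominatedCount k a b =
    binomial (a ℕ.+ k) (+ k) * binomial (b ℕ.+ k) (+ k) - binomial (a ℕ.+ k) (+ suc k) * binomial (b ℕ.+ k) (+ k - + 1)

  extendSecondCount : ℕ → ℕ → ℕ → ℤ
  extendSecondCount k a b =
    binomial (a ℕ.+ k) (+ k) * binomial (b ℕ.+ suc k) (+ suc k) - binomial (a ℕ.+ k) (+ suc k) * binomial (b ℕ.+ suc k) (+ k)

  extendSecondCount-step : ∀ k a b → dominatedCount k a (suc b) + extendSecondCount k a b ≡ extendSecondCount k a (suc b)
  extendSecondCount-step k a b = step (binomial (a ℕ.+ k) (+ k)) (binomial (a ℕ.+ k) (+ suc k)) (sym (ℕ.+-suc b k))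
    where
    step : ∀ X Y {M′ M} → M′ ≡ M →
      X * binomial M′ (+ k) - Y * binomial M′ (+ k - + 1) + (X * binomial M (+ suc k) - Y * binomial M (+ k))
      ≡ X * binomial (suc M) (+ suc k) - Y * binomial (suc M) (+ k)
    step X Y {M = M} refl =
      trans (pascal-sums X Y (binomial M (+ suc k)) (binomial M (+ k)) (binomial M (+ k - + 1)))
            (cong (λ z → X * (binomial M (+ suc k) + binomial M (+ k)) - Y * z) (sym (binomial-pascal M (+ k))))
      where
      pascal-sums : ∀ X Y B₁ B₀ B₋ → X * B₀ - Y * B₋ + (X * B₁ - Y * B₀) ≡ X * (B₁ + B₀) - Y * (B₀ + B₋)
      pascal-sums = solve-∀

  extendSecondCount-over : ∀ k b → extendSecondCount k (suc b) b ≡ + 0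
  extendSecondCount-over k b = cancel (sym (ℕ.+-suc b k))
    where
    cancel : ∀ {M M′} → M′ ≡ M →
      binomial M′ (+ k) * binomial M (+ suc k) - binomial M′ (+ suc k) * binomial M (+ k) ≡ + 0
    cancel {M} refl = x*y-y*x≡0 (binomial M (+ k)) (binomial M (+ suc k))
      where
      x*y-y*x≡0 : ∀ x y → x * y - y * x ≡ + 0
      x*y-y*x≡0 = solve-∀

  extendSecondCount-base : ∀ k → dominatedCount k 0 0 ≡ extendSecondCount k 0 0
  extendSecondCount-base k =
    base (binomial k (+ k)) (binomial k (+ suc k)) (binomial k (+ k - + 1)) (binomial (suc k) (+ k))
         (binomial-diag k) (binomial-> k (suc k) (ℕ.n<1+n k))
    where
    base : ∀ D Z w w′ → D ≡ + 1 → Z ≡ + 0 → D * D - Z * w ≡ D * (Z + D) - Z * w′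
    base _ _ w w′ refl refl = one w w′
      where
      one : ∀ w w′ → + 1 * + 1 - + 0 * w ≡ + 1 * (+ 0 + + 1) - + 0 * w′
      one = solve-∀

  extendCount-base : ∀ k b → extendSecondCount k 0 b ≡ dominatedCount (suc k) 0 b
  extendCount-base k b =
    base (binomial k (+ k)) (binomial k (+ suc k)) (binomial k (+ suc (suc k)))
         (binomial (b ℕ.+ suc k) (+ suc k)) (binomial (b ℕ.+ suc k) (+ k))
         (binomial-diag k) (binomial-> k (suc k) (ℕ.n<1+n k))
         (binomial-> k (suc (suc k)) (ℕ.<-trans (ℕ.n<1+n k) (ℕ.n<1+n (suc k))))
    where
    base : ∀ D Z Z′ B₁ B₀ → D ≡ + 1 → Z ≡ + 0 → Z′ ≡ + 0 → D * B₁ - Z * B₀ ≡ (Z + D) * B₁ - (Z′ + Z) * B₀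
    base _ _ _ B₁ B₀ refl refl refl = one B₁ B₀
      where
      one : ∀ B₁ B₀ → + 1 * B₁ - + 0 * B₀ ≡ (+ 0 + + 1) * B₁ - (+ 0 + + 0) * B₀
      one = solve-∀

  extendCount-step : ∀ k a b → extendSecondCount k (suc a) b + dominatedCount (suc k) a b ≡ dominatedCount (suc k) (suc a) b
  extendCount-step k a b =
    step (binomial (b ℕ.+ suc k) (+ suc k)) (binomial (b ℕ.+ suc k) (+ k)) (sym (ℕ.+-suc a k))
    where
    step : ∀ B₁ B₀ {Q′ Q} → Q′ ≡ Q →
      binomial Q′ (+ k) * B₁ - binomial Q′ (+ suc k) * B₀ + (binomial Q (+ suc k) * B₁ - binomial Q (+ suc (suc k)) * B₀)
      ≡ (binomial Q (+ suc k) + binomial Q (+ k)) * B₁ - (binomial Q (+ suc (suc k)) + binomial Q (+ suc k)) * B₀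
    step B₁ B₀ {Q = Q} refl = pascal-sums (binomial Q (+ k)) (binomial Q (+ suc k)) (binomial Q (+ suc (suc k))) B₁ B₀
      where
      pascal-sums : ∀ Q₀ Q₁ Q₂ B₁ B₀ → Q₀ * B₁ - Q₁ * B₀ + (Q₁ * B₁ - Q₂ * B₀) ≡ (Q₁ + Q₀) * B₁ - (Q₂ + Q₁) * B₀
      pascal-sums = solve-∀

  length-extendSecond-over : ∀ k b a → b < a → length (extendSecond (dominatedPairs (suc k)) a b) ≡ 0
  length-extendSecond-over k zero    a b<a = trans (length-map cons₀ (dominatedPairs (suc k) a zero)) (length-dominatedPairs-> k b<a)
  length-extendSecond-over k (suc b) a b<a = trans (length-extendSecond-suc (dominatedPairs (suc k)) a b)
    (cong₂ ℕ._+_ (length-dominatedPairs-> k b<a) (length-extendSecond-over k b a (ℕ.<-trans (ℕ.n<1+n b) b<a)))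

  module _ k (length-dominated : ∀ a b → a ≤ b → + length (dominatedPairs (suc k) a b) ≡ dominatedCount k a b) where

    length-extendSecond : ∀ b a → a ≤ suc b → + length (extendSecond (dominatedPairs (suc k)) a b) ≡ extendSecondCount k a b
    length-extendSecond zero zero _ =
      trans (cong +_ (length-map cons₀ (dominatedPairs (suc k) 0 0))) (trans (length-dominated 0 0 z≤n) (extendSecondCount-base k))
    length-extendSecond zero (suc zero) _ =
      trans (cong +_ (trans (length-map cons₀ (dominatedPairs (suc k) 1 0)) (length-dominatedPairs-> k {1} {0} (s≤s z≤n))))
            (sym (extendSecondCount-over k 0))
    length-extendSecond zero (suc (suc a)) (s≤s ())
    length-extendSecond (suc b) a a≤ with ℕ.≤-<-connex a (suc b)
    ... | inj₁ a≤b = trans (cong +_ (length-extendSecond-suc (dominatedPairs (suc k)) a b))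
                       (trans (cong₂ _+_ (length-dominated a (suc b) a≤b) (length-extendSecond b a a≤b))
                              (extendSecondCount-step k a b))
    ... | inj₂ b<a with ℕ.≤-antisym a≤ b<a
    ...   | refl = trans (cong +_ (length-extendSecond-over k (suc b) (suc (suc b)) (ℕ.n<1+n (suc b))))
                         (sym (extendSecondCount-over k (suc b)))

    length-extend : ∀ a b → a ≤ suc b → + length (extend (dominatedPairs (suc k)) a b) ≡ dominatedCount (suc k) a b
    length-extend zero    b a≤ = trans (length-extendSecond b 0 z≤n) (extendCount-base k b)
    length-extend (suc a) b a≤ = trans (cong +_ (length-extend-suc (dominatedPairs (suc k)) a b))
      (trans (cong₂ _+_ (length-extendSecond b (suc a) a≤) (length-extend a b (ℕ.≤-trans (ℕ.n≤1+n a) a≤)))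
             (extendCount-step k a b))

  length-extend-singletons : ∀ a b → length (extend (dominatedPairs 0) a b) ≡ 1
  length-extend-singletons zero    b = zeroFirst b
    where
    zeroFirst : ∀ b → length (extendSecond (dominatedPairs 0) 0 b) ≡ 1
    zeroFirst zero    = refl
    zeroFirst (suc b) = trans (length-extendSecond-suc (dominatedPairs 0) 0 b) (zeroFirst b)
  length-extend-singletons (suc a) b = trans (length-extend-suc (dominatedPairs 0) a b)
    (cong₂ ℕ._+_ (positiveFirst b) (length-extend-singletons a b))
    where
    positiveFirst : ∀ b → length (extendSecond (dominatedPairs 0) (suc a) b) ≡ 0
    positiveFirst zero    = refl
    positiveFirst (suc b) = trans (length-extendSecond-suc (dominatedPairs 0) (suc a) b) (positiveFirst b)

  length-dominatedPairs : ∀ k a b → a ≤ b → + length (dominatedPairs (suc k) a b) ≡ dominatedCount k a b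
  length-dominatedPairs zero a b a≤b
    rewrite length-dominatedPairs-≤ 0 a≤b | length-extend-singletons a b | binomial-zero (a ℕ.+ 0) | binomial-zero (b ℕ.+ 0) =
    sym (one (binomial (a ℕ.+ 0) (+ 1)))
    where
    one : ∀ x → + 1 * + 1 - x * + 0 ≡ + 1
    one = solve-∀
  length-dominatedPairs (suc k) a b a≤b = trans (cong +_ (length-dominatedPairs-≤ (suc k) a≤b))
    (length-extend k (length-dominatedPairs k) a b (ℕ.≤-trans a≤b (ℕ.n≤1+n b)))

  length-compositions : ∀ k s → + length (compositions (suc k) s) ≡ binomial (s ℕ.+ k) (+ k)
  length-compositions zero s = trans (cong +_ (single s)) (sym (binomial-zero (s ℕ.+ 0)))
    where
    single : ∀ s → length (compositions 1 s) ≡ 1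
    single zero    = refl
    single (suc s) = trans (length-compositions-suc 0 s) (single s)
  length-compositions (suc k) zero =
    trans (cong +_ (length-map (0 ∷_) (compositions (suc k) zero)))
          (trans (length-compositions k 0) (trans (binomial-diag k) (sym (binomial-diag (suc k)))))
  length-compositions (suc k) (suc s) =
    trans (cong +_ (length-compositions-suc (suc k) s))
      (trans (cong₂ _+_ (length-compositions k (suc s)) (length-compositions (suc k) s))
        (trans (cong (λ M → binomial M (+ k) + binomial (s ℕ.+ suc k) (+ suc k)) (sym (ℕ.+-suc s k)))
          (trans (ℤ.+-comm (binomial (s ℕ.+ suc k) (+ k)) _) (sym (binomial-pascal (s ℕ.+ suc k) (+ suc k))))))

  binomial-absorption-upper : ∀ s m → + suc m * binomial (s ℕ.+ m) (+ suc m) ≡ + s * binomial (s ℕ.+ m) (+ m)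
  binomial-absorption-upper s m = begin
    + suc m * binomial (s ℕ.+ m) (+ suc m)
      ≡⟨ cong (λ k → k * binomial (s ℕ.+ m) k) (cong +_ (ℕ.+-comm 1 m)) ⟩
    (+ m + + 1) * binomial (s ℕ.+ m) (+ m + + 1)
      ≡⟨ binomial-absorption (s ℕ.+ m) (+ m) ⟩
    (+ (s ℕ.+ m) - + m) * binomial (s ℕ.+ m) (+ m)
      ≡⟨ cong (_* binomial (s ℕ.+ m) (+ m)) (trans (cong (_- + m) (ℤ.pos-+ s m)) (x+y-y≡x (+ s) (+ m))) ⟩
    + s * binomial (s ℕ.+ m) (+ m) ∎
    where
    open ≡-Reasoning
    x+y-y≡x : ∀ x y → x + y - y ≡ x
    x+y-y≡x = solve-∀

  binomial-absorption-lower : ∀ s m → + suc s * binomial (s ℕ.+ m) (+ m - + 1) ≡ + m * binomial (s ℕ.+ m) (+ m)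
  binomial-absorption-lower s m = sym (begin
    + m * binomial (s ℕ.+ m) (+ m)
      ≡⟨ cong (λ k → k * binomial (s ℕ.+ m) k) (sym (x-1+1≡x (+ m))) ⟩
    (+ m - + 1 + + 1) * binomial (s ℕ.+ m) (+ m - + 1 + + 1)
      ≡⟨ binomial-absorption (s ℕ.+ m) (+ m - + 1) ⟩
    (+ (s ℕ.+ m) - (+ m - + 1)) * binomial (s ℕ.+ m) (+ m - + 1)
      ≡⟨ cong (_* binomial (s ℕ.+ m) (+ m - + 1)) (trans (cong (_- (+ m - + 1)) (ℤ.pos-+ s m)) (x+y-[y-1]≡1+x (+ s) (+ m))) ⟩
    + suc s * binomial (s ℕ.+ m) (+ m - + 1) ∎)
    where
    open ≡-Reasoning
    x-1+1≡x : ∀ x → x - + 1 + + 1 ≡ x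
    x-1+1≡x = solve-∀
    x+y-[y-1]≡1+x : ∀ x y → x + y - (y - + 1) ≡ + 1 + x
    x+y-[y-1]≡1+x = solve-∀

  binomial-absorption-suc : ∀ s m → + suc m * binomial (s ℕ.+ suc m) (+ suc m) ≡ + (s ℕ.+ suc m) * binomial (s ℕ.+ m) (+ m)
  binomial-absorption-suc s m = begin
    + suc m * binomial (s ℕ.+ suc m) (+ suc m)
      ≡⟨ cong (λ n → + suc m * binomial n (+ suc m)) (ℕ.+-suc s m) ⟩
    + suc m * (binomial (s ℕ.+ m) (+ suc m) + binomial (s ℕ.+ m) (+ m))
      ≡⟨ ℤ.*-distribˡ-+ (+ suc m) (binomial (s ℕ.+ m) (+ suc m)) (binomial (s ℕ.+ m) (+ m)) ⟩
    + suc m * binomial (s ℕ.+ m) (+ suc m) + + suc m * binomial (s ℕ.+ m) (+ m)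
      ≡⟨ cong (_+ + suc m * binomial (s ℕ.+ m) (+ m)) (binomial-absorption-upper s m) ⟩
    + s * binomial (s ℕ.+ m) (+ m) + + suc m * binomial (s ℕ.+ m) (+ m)
      ≡⟨ ℤ.*-distribʳ-+ (binomial (s ℕ.+ m) (+ m)) (+ s) (+ suc m) ⟨
    + (s ℕ.+ suc m) * binomial (s ℕ.+ m) (+ m) ∎
    where open ≡-Reasoning

  rising≡binomial*! : ∀ s m → + rising s m ≡ binomial (s ℕ.+ m) (+ m) * + (m !)
  rising≡binomial*! s zero    = sym (cong (_* + 1) (binomial-zero (s ℕ.+ 0)))
  rising≡binomial*! s (suc m) = begin
    + (rising s m ℕ.* (s ℕ.+ suc m))        ≡⟨ ℤ.pos-* (rising s m) (s ℕ.+ suc m) ⟩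
    + rising s m * + (s ℕ.+ suc m)          ≡⟨ cong (_* + (s ℕ.+ suc m)) (rising≡binomial*! s m) ⟩
    B * + (m !) * + (s ℕ.+ suc m)           ≡⟨ reorder B (+ (m !)) (+ (s ℕ.+ suc m)) ⟩
    + (s ℕ.+ suc m) * B * + (m !)           ≡⟨ cong (_* + (m !)) (binomial-absorption-suc s m) ⟨
    + suc m * B′ * + (m !)                  ≡⟨ reorder′ (+ suc m) B′ (+ (m !)) ⟩
    B′ * (+ suc m * + (m !))                ≡⟨ cong (B′ *_) (ℤ.pos-* (suc m) (m !)) ⟨
    B′ * + (suc m ℕ.* m !)                  ∎
    where
    open ≡-Reasoning
    B  = binomial (s ℕ.+ m) (+ m)
    B′ = binomial (s ℕ.+ suc m) (+ suc m)
    reorder : ∀ x y z → x * y * z ≡ z * x * y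
    reorder = solve-∀
    reorder′ : ∀ x y z → x * y * z ≡ y * (x * z)
    reorder′ = solve-∀

  -- The factors (m + 1) and (s + 1) turn the two subtracted binomials into multiples of the first ones.
  dominatedCount-diagonal : ∀ s m →
    (+ suc m * + suc s) * dominatedCount m s s ≡ + (s ℕ.+ suc m) * (binomial (s ℕ.+ m) (+ m) * binomial (s ℕ.+ m) (+ m))
  dominatedCount-diagonal s m = begin
    (+ suc m * + suc s) * (B * B - Y * Z)         ≡⟨ expand (+ suc m) (+ suc s) B Y Z ⟩
    (+ suc m * + suc s) * (B * B) - (+ suc m * Y) * (+ suc s * Z)
      ≡⟨ cong₂ (λ u v → (+ suc m * + suc s) * (B * B) - u * v)
               (binomial-absorption-upper s m) (binomial-absorption-lower s m) ⟩
    (+ suc m * + suc s) * (B * B) - (+ s * B) * (+ m * B)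
      ≡⟨ cong₂ (λ u v → (u * v) * (B * B) - (+ s * B) * (+ m * B)) (ℤ.pos-+ 1 m) (ℤ.pos-+ 1 s) ⟩
    ((+ 1 + + m) * (+ 1 + + s)) * (B * B) - (+ s * B) * (+ m * B)
      ≡⟨ collect (+ m) (+ s) B ⟩
    (+ 1 + + s + + m) * (B * B)
      ≡⟨ cong (_* (B * B)) (trans (sym (cong (_+ + m) (ℤ.pos-+ 1 s)))
                                  (trans (sym (ℤ.pos-+ (suc s) m)) (cong +_ (sym (ℕ.+-suc s m))))) ⟩
    + (s ℕ.+ suc m) * (B * B) ∎
    where
    open ≡-Reasoning
    B = binomial (s ℕ.+ m) (+ m)
    Y = binomial (s ℕ.+ m) (+ suc m)
    Z = binomial (s ℕ.+ m) (+ m - + 1)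
    expand : ∀ p q B Y Z → (p * q) * (B * B - Y * Z) ≡ (p * q) * (B * B) - (p * Y) * (q * Z)
    expand = solve-∀
    collect : ∀ m s B → ((+ 1 + m) * (+ 1 + s)) * (B * B) - (s * B) * (m * B) ≡ (+ 1 + s + m) * (B * B)
    collect = solve-∀

open Transport using (isEMC⇔comparable)
open Enumeration
open BinomialCounts
open import Data.Nat as ℕ using (ℕ; suc; NonZero; _!)
import Data.Nat.Properties as ℕ
open import Data.Integer using (+_; _+_; _*_; _-_; -_)
import Data.Integer.Properties as ℤ
open import Data.Integer.Tactic.RingSolver using (solve-∀)
open import Data.Rational as ℚ using (_/_; toℚᵘ)
import Data.Rational.Properties as ℚ
open import Data.Rational.Unnormalised as ℚᵘ using (mkℚᵘ; *≡*)
import Data.Rational.Unnormalised.Properties as ℚᵘ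

toℚᵘ-/ : ∀ i d .{{_ : NonZero d}} → toℚᵘ (i / d) ℚᵘ.≃ (i ℚᵘ./ d)
toℚᵘ-/ i (suc d) = ℚ.toℚᵘ-fromℚᵘ (mkℚᵘ i d)

/*/1≡*/ : ∀ i j d .{{_ : NonZero d}} → (i / d) ℚ.* (j / 1) ≡ (i * j) / d
/*/1≡*/ i j d@(suc _) = ℚ.toℚᵘ-injective (begin
  toℚᵘ ((i / d) ℚ.* (j / 1))           ≈⟨ ℚ.toℚᵘ-homo-* (i / d) (j / 1) ⟩
  toℚᵘ (i / d) ℚᵘ.* toℚᵘ (j / 1)       ≈⟨ ℚᵘ.*-cong (toℚᵘ-/ i d) (toℚᵘ-/ j 1) ⟩
  (i ℚᵘ./ d) ℚᵘ.* (j ℚᵘ./ 1)           ≈⟨ *≡* (cong (λ x → (i * j) * + x) (sym (ℕ.*-identityʳ d))) ⟩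
  (i * j) ℚᵘ./ d                       ≈⟨ toℚᵘ-/ (i * j) d ⟨
  toℚᵘ ((i * j) / d)                   ∎)
  where open ℚᵘ.≃-Reasoning

/≡/1 : ∀ i k d .{{_ : NonZero d}} → i ≡ k * + d → i / d ≡ k / 1
/≡/1 i k d@(suc _) i≡kd = ℚ.toℚᵘ-injective (begin
  toℚᵘ (i / d)   ≈⟨ toℚᵘ-/ i d ⟩
  i ℚᵘ./ d       ≈⟨ *≡* (trans (ℤ.*-identityʳ i) i≡kd) ⟩
  k ℚᵘ./ 1       ≈⟨ toℚᵘ-/ k 1 ⟨
  toℚᵘ (k / 1)   ∎)
  where open ℚᵘ.≃-Reasoning

/1-/1≡-/1 : ∀ i j → (i / 1) ℚ.- (j / 1) ≡ (i - j) / 1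
/1-/1≡-/1 i j = ℚ.toℚᵘ-injective (begin
  toℚᵘ ((i / 1) ℚ.- (j / 1))                 ≈⟨ ℚ.toℚᵘ-homo-+ (i / 1) (ℚ.- (j / 1)) ⟩
  toℚᵘ (i / 1) ℚᵘ.+ toℚᵘ (ℚ.- (j / 1))
    ≈⟨ ℚᵘ.+-cong (toℚᵘ-/ i 1) (ℚᵘ.≃-trans (ℚ.toℚᵘ-homo‿- (j / 1)) (ℚᵘ.-‿cong (toℚᵘ-/ j 1))) ⟩
  (i ℚᵘ./ 1) ℚᵘ.- (j ℚᵘ./ 1)                 ≈⟨ *≡* (cross i j) ⟩
  (i - j) ℚᵘ./ 1                             ≈⟨ toℚᵘ-/ (i - j) 1 ⟨
  toℚᵘ ((i - j) / 1)                         ∎)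
  where
  open ℚᵘ.≃-Reasoning
  cross : ∀ i j → (i * + 1 + - j * + 1) * + 1 ≡ (i - j) * + (1 ℕ.* 1)
  cross = solve-∀

length≡length-compositions : ∀ s n {Cs : List (Vec ℕ n)} → Unique Cs → (∀ α → α ∈ Cs ⇔ InC s n α) →
  length Cs ≡ length (compositions n s)
length≡length-compositions s n Cs! Cs⇔ = unique∧sameMembers⇒length≡ Cs! (compositions-unique n s)
  (λ α → mk⇔ (from (∈compositions⇔ n s α) ∘ to (Cs⇔ α)) (from (Cs⇔ α) ∘ to (∈compositions⇔ n s α)))

length≡length-comparablePairs : ∀ s n {Good : List (Vec ℕ n × Vec ℕ n)} → Unique Good →
  (∀ α β → (α , β) ∈ Good ⇔ (InC s n α × InC s n β × IsEMC α β ℤ.∣ 𝒟 α β ∣)) →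
  length Good ≡ length (comparablePairs n s)
length≡length-comparablePairs s n {Good} Good! Good⇔ = unique∧sameMembers⇒length≡ Good! (comparablePairs-unique n s) same
  where
  same : ∀ p → p ∈ Good ⇔ p ∈ comparablePairs n s
  same (α , β) = mk⇔
    (λ p∈ → let (sumα , sumβ , emc) = to (Good⇔ α β) p∈
            in from (∈comparablePairs⇔ n s α β) (sumα , sumβ , to (isEMC⇔comparable s α β sumα sumβ) emc))
    (λ p∈ → let (sumα , sumβ , comparable) = to (∈comparablePairs⇔ n s α β) p∈
            in from (Good⇔ α β) (sumα , sumβ , from (isEMC⇔comparable s α β sumα sumβ) comparable))

module _ (s m : ℕ) where

  private
    N = length (compositions (suc m) s)
    P = length (dominatedPairs (suc m) s s)
    B = binomial (s ℕ.+ m) (+ m)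

    N≡B : + N ≡ B
    N≡B = length-compositions m s

  pairs*[n*[s+1]]≡2*[s+n]*N² : + (P ℕ.+ P) * + (suc m ℕ.* suc s) ≡ + (2 ℕ.* (s ℕ.+ suc m)) * + (N ℕ.* N)
  pairs*[n*[s+1]]≡2*[s+n]*N² = begin
    + (P ℕ.+ P) * + (suc m ℕ.* suc s)               ≡⟨ cong₂ _*_ (ℤ.pos-+ P P) (ℤ.pos-* (suc m) (suc s)) ⟩
    (+ P + + P) * (+ suc m * + suc s)               ≡⟨ double (+ P) (+ suc m * + suc s) ⟩
    + 2 * ((+ suc m * + suc s) * + P)
      ≡⟨ cong (λ x → + 2 * ((+ suc m * + suc s) * x)) (length-dominatedPairs m s s ℕ.≤-refl) ⟩
    + 2 * ((+ suc m * + suc s) * dominatedCount m s s) ≡⟨ cong (+ 2 *_) (dominatedCount-diagonal s m) ⟩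
    + 2 * (+ (s ℕ.+ suc m) * (B * B))               ≡⟨ cong (λ x → + 2 * (+ (s ℕ.+ suc m) * (x * x))) N≡B ⟨
    + 2 * (+ (s ℕ.+ suc m) * (+ N * + N))           ≡⟨ assoc (+ 2) (+ (s ℕ.+ suc m)) (+ N * + N) ⟩
    + 2 * + (s ℕ.+ suc m) * (+ N * + N)             ≡⟨ cong₂ _*_ (ℤ.pos-* 2 (s ℕ.+ suc m)) (ℤ.pos-* N N) ⟨
    + (2 ℕ.* (s ℕ.+ suc m)) * + (N ℕ.* N)           ∎
    where
    open ≡-Reasoning
    double : ∀ p q → (p + p) * q ≡ + 2 * (q * p)
    double = solve-∀
    assoc : ∀ x y z → x * (y * z) ≡ x * y * z
    assoc = solve-∀

  N*rising≡m!*N² : + N * + rising s m ≡ + (m !) * + (N ℕ.* N)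
  N*rising≡m!*N² = begin
    + N * + rising s m         ≡⟨ cong (+ N *_) (rising≡binomial*! s m) ⟩
    + N * (B * + (m !))        ≡⟨ cong (λ x → + N * (x * + (m !))) N≡B ⟨
    + N * (+ N * + (m !))      ≡⟨ reorder (+ N) (+ (m !)) ⟩
    + (m !) * (+ N * + N)      ≡⟨ cong (+ (m !) *_) (ℤ.pos-* N N) ⟨
    + (m !) * + (N ℕ.* N)      ∎
    where
    open ≡-Reasoning
    reorder : ∀ n f → n * (n * f) ≡ f * (n * n)
    reorder = solve-∀

+[m+n]-+n≡+m : ∀ m n → + (m ℕ.+ n) - + n ≡ + m
+[m+n]-+n≡+m m n = trans (ℤ.[+m]-[+n]≡m⊖n (m ℕ.+ n) n) (trans (ℤ.⊖-≥ (ℕ.m≤n+m n m)) (cong +_ (ℕ.m+n∸n≡m m n)))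

theorem2 : (s n : ℕ) → .{{_ : NonZero s}} → .{{_ : NonZero n}} →
    (Cs : List (Vec ℕ n)) → Unique Cs →
    ((α : Vec ℕ n) → (α ∈ Cs) ⇔ InC s n α) →
    (Good : List (Vec ℕ n × Vec ℕ n)) → Unique Good →
    ((α β : Vec ℕ n) →
    ((α , β) ∈ Good) ⇔ (InC s n α × InC s n β × IsEMC α β ℤ.∣ 𝒟 α β ∣)) →
    (+ length Good / 1) ≡ formula s n ℚ.* (+ (length Cs ℕ.* length Cs) / 1)
theorem2 s (suc m) Cs Cs! Cs⇔ Good Good! Good⇔
  rewrite length≡length-compositions s (suc m) Cs! Cs⇔ | length≡length-comparablePairs s (suc m) Good! Good⇔ = begin
  + G / 1                           ≡⟨ cong (_/ 1) 2P-N≡G ⟨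
  (+ (P ℕ.+ P) - + N) / 1           ≡⟨ /1-/1≡-/1 (+ (P ℕ.+ P)) (+ N) ⟨
  + (P ℕ.+ P) / 1 ℚ.- + N / 1       ≡⟨ cong₂ ℚ._-_ A*X≡2P B*X≡N ⟨
  A ℚ.* X ℚ.- B ℚ.* X               ≡⟨ cong (A ℚ.* X ℚ.+_) (ℚ.neg-distribˡ-* B X) ⟩
  A ℚ.* X ℚ.+ (ℚ.- B) ℚ.* X         ≡⟨ ℚ.*-distribʳ-+ X A (ℚ.- B) ⟨
  (A ℚ.- B) ℚ.* X                   ∎
  where
  open ≡-Reasoning
  G = length (comparablePairs (suc m) s)
  N = length (compositions (suc m) s)
  P = length (dominatedPairs (suc m) s s)
  A = + (2 ℕ.* (s ℕ.+ suc m)) / (suc m ℕ.* suc s)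
  B = (+ (m !) / rising s m) {{rising-nonZero s m}}
  X = + (N ℕ.* N) / 1
  2P-N≡G : + (P ℕ.+ P) - + N ≡ + G
  2P-N≡G = trans (cong (λ x → + x - + N) (sym (length-comparablePairs (suc m) s))) (+[m+n]-+n≡+m G N)
  A*X≡2P : A ℚ.* X ≡ + (P ℕ.+ P) / 1
  A*X≡2P = trans (/*/1≡*/ (+ (2 ℕ.* (s ℕ.+ suc m))) (+ (N ℕ.* N)) (suc m ℕ.* suc s))
                 (/≡/1 _ (+ (P ℕ.+ P)) (suc m ℕ.* suc s) (sym (pairs*[n*[s+1]]≡2*[s+n]*N² s m)))
  B*X≡N : B ℚ.* X ≡ + N / 1
  B*X≡N = trans (/*/1≡*/ (+ (m !)) (+ (N ℕ.* N)) (rising s m) {{rising-nonZero s m}})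
                (/≡/1 _ (+ N) (rising s m) {{rising-nonZero s m}} (sym (N*rising≡m!*N² s m)))
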